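{- Let $\Gamma,\pi,\breve\Gamma,\circ$, the involutions $\beta\mapsto\beta^{\perp(\gamma)}$ and the $\mathbb Z$-torsors $[\alpha,\beta]$ be as in the context. Then: (1) for all $\gamma_1,\gamma_2\in\Gamma$ and $\beta\in\breve\Gamma$: $\beta^{\perp(\gamma_1+\gamma_2)}=(-\gamma_2)\circ\beta^{\perp(\gamma_1)}$; (2) for all $\phi,\gamma\in\Gamma$ and $\alpha\in\breve\Gamma$: $(\phi\circ\alpha)^{\perp(\gamma)}=(-\phi)\circ\alpha^{\perp(\gamma)}$; (3) for every $\gamma\in\Gamma$ and $\alpha,\beta\in\breve\Gamma$ there is a canonical isomorphism of $\mathbb Z$-torsors $\psi_{\alpha,\beta}:[\alpha,\beta]\to[\alpha^{\perp(\gamma)},\beta^{\perp(\gamma)}]$, and these isomorphisms are compatible with the canonical isomorphisms $[\alpha,\alpha]\cong\mathbb Z$ and $[\alpha,\beta]\otimes_{\mathbb Z}[\beta,\delta]\cong[\alpha,\delta]$ for any three elements $\alpha,\beta,\delta\in\breve\Gamma$; (4) for all $\phi,\gamma\in\Gamma$ and $\alpha,\beta\in\breve\Gamma$, the square formed by $\psi_{\alpha,\beta}:[\alpha,\beta]\to[\alpha^{\perp(\gamma)},\beta^{\perp(\gamma)}]$, $\psi_{\phi\circ\alpha,\phi\circ\beta}:[\phi\circ\alpha,\phi\circ\beta]\to[(\phi\circ\alpha)^{\perp(\gamma)},(\phi\circ\beta)^{\perp(\gamma)}]=[(-\phi)\circ\alpha^{\perp(\gamma)},(-\phi)\circ\beta^{\perp(\gamma)}]$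 (using (2)), and the isomorphisms $[\alpha,\beta]\to[\phi\circ\alpha,\phi\circ\beta]$ and $[\alpha^{\perp(\gamma)},\beta^{\perp(\gamma)}]\to[(-\phi)\circ\alpha^{\perp(\gamma)},(-\phi)\circ\beta^{\perp(\gamma)}]$ induced by the actions of $\phi$ and $-\phi$, is commutative.
   Context: $\Gamma$ is an abelian group with a fixed exact sequence $0\to\mathbb Z\to\Gamma\xrightarrow{\pi}\mathbb Z\to0$ (no splitting fixed); each fibre $\pi^{ -1}(n)$ is a $\mathbb Z$-torsor via $\ker\pi=\mathbb Z$. $\Gamma$ is linearly ordered by: $\gamma_1>\gamma_2$ iff $\pi(\gamma_1)>\pi(\gamma_2)$, or $\pi(\gamma_1)=\pi(\gamma_2)$ and $\gamma_1-\gamma_2\in\ker\pi$ is positive. $\breve\Gamma=\Gamma\sqcup\pi(\Gamma)$, elements of $\pi(\Gamma)$ written $(n,-\infty)$, elements of $\Gamma$ as $(n,p)$, $p\in\pi^{ -1}(n)$; $\breve\pi$ extends $\pi$ by $\breve\pi(n,-\infty)=n$; order: $\alpha_1<\alpha_2$ if $\breve\pi(\alpha_1)<\breve\pi(\alpha_2)$, $(n,-\infty)<(n,p)$, and the order of $\Gamma$ on fibres. Commutative operation $\circ$ on $\breve\Gamma$: addition on $\Gamma$, $(n,p)\circ(m,-\infty)=(n+m,-\infty)$, $(n,-\infty)\circ(m,-\infty)=(n+m,-\infty)$. For $\gamma\in\Gamma$ and $\beta\in\breve\Gamma$, $\beta^{\perp(\gamma)}$ is the minimum of $\{\varphi\in\breve\Gamma:\varphi\circ\beta\circ\gamma>0\}$.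 Torsors: for subsets $A,B$ write $A\sim B$ if their symmetric difference is finite. For $\alpha\ge\beta$ let $R_{\alpha,\beta}=\{\gamma\in\Gamma:\alpha>\gamma\ge\beta\}$, $Y\subset R_{\alpha,\beta}$ containing exactly one point of each nonempty $\pi^{ -1}(n)\cap R_{\alpha,\beta}$, $\tau$ the family of $A\subset R_{\alpha,\beta}$ with $A\sim(\mathbb Z_{\ge0}+Y)\cap R_{\alpha,\beta}$ (independent of $Y$); $[\alpha,\beta]$ is the $\mathbb Z$-torsor of maps $d:\tau\to\mathbb Z$ with $d(A_2)=d(A_1)+|A_2\setminus A_1|$ for $A_1\subset A_2$, with $(a+d)(A)=d(A)+a$ ($=\mathbb Z$ if $R_{\alpha,\beta}=\emptyset$); for $\alpha\le\beta$, $[\alpha,\beta]=[\beta,\alpha]^*$ (same set, opposite action). Canonical isomorphisms $[\alpha,\alpha]\cong\mathbb Z$, $[\alpha,\beta]\otimes_{\mathbb Z}[\beta,\delta]\cong[\alpha,\delta]$: for $\alpha\ge\beta\ge\delta$, $(d_1\otimes d_2)(A_1\sqcup A_2)=d_1(A_1)+d_2(A_2)$, and in other orderings induced via the pairing $P\otimes P^*\to\mathbb Z$, $(p,q)\mapsto a$ where $p=q+a$. For $\phi\in\Gamma$, translation by $\phi$ maps $R_{\alpha,\beta}$ onto $R_{\phi\circ\alpha,\phi\circ\beta}$ and induces $[\alpha,\beta]\to[\phi\circ\alpha,\phi\circ\beta]$, $d\mapsto(A\mapsto d(A-\phi))$. -}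

module Defs where

open import Level using (0ℓ)
open import Data.Bool using (Bool; true; false; _∨_)
open import Data.Empty using (⊥)
open import Data.Integer as ℤ using (ℤ; 0ℤ)
open import Data.Integer.Base using () renaming (+_ to ℤ⁺)
import Data.Integer.Properties as ℤP
open import Data.List using (List; length)
open import Data.List.Membership.Propositional using (_∈_)
open import Data.List.Relation.Unary.Unique.Propositional using (Unique)
open import Data.Product using (Σ; _×_; _,_; proj₁; proj₂)
open import Data.Sum using (_⊎_; inj₁; inj₂)
open import Relation.Nullary using (¬_)
open import Relation.Binary using (Tri; tri<; tri≈; tri>)
open import Relation.Binary.PropositionalEquality
open import Algebra.Structures using (IsAbelianGroup)
open import Algebra.Bundles using (AbelianGroup)
import Algebra.Properties.AbelianGroup as AGP

record ExtGroup : Set₁ where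
  infixl 6 _+_
  field
    Carrier        : Set
    _+_            : Carrier → Carrier → Carrier
    0#             : Carrier
    -_             : Carrier → Carrier
    isAbelianGroup : IsAbelianGroup _≡_ _+_ 0# -_
    ι              : ℤ → Carrier
    π              : Carrier → ℤ
    ι-hom          : ∀ a b → ι (a ℤ.+ b) ≡ ι a + ι b
    π-hom          : ∀ x y → π (x + y) ≡ π x ℤ.+ π y
    ι-injective    : ∀ a b → ι a ≡ ι b → a ≡ b
    π-surjective   : ∀ n → Σ Carrier (λ x → π x ≡ n)
    im⊆ker         : ∀ a → π (ι a) ≡ 0ℤ
    ker⊆im         : ∀ x → π x ≡ 0ℤ → Σ ℤ (λ a → ι a ≡ x)

module WithGroup (G : ExtGroup) where
  open ExtGroup G public

  infixl 6 _-_
  _-_ : Carrier → Carrier → Carrier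
  x - y = x + (- y)

  bundle : AbelianGroup 0ℓ 0ℓ
  bundle = record { isAbelianGroup = isAbelianGroup }

  private
    module GP = AGP bundle
    module ZP = AGP ℤP.+-0-abelianGroup
    module IG = IsAbelianGroup isAbelianGroup

  data _<Γ_ (x y : Carrier) : Set where
    by-π   : π x ℤ.< π y → x <Γ y
    by-ker : π x ≡ π y → (k : ℤ) → 0ℤ ℤ.< k → ι k ≡ y - x → x <Γ y

  -- Γ̆ = Γ ⊔ π(Γ) ;  fin p  is (π p , p),  ninf n  is (n , -∞).

  data Breve : Set where
    fin  : Carrier → Breve
    ninf : ℤ → Breve

  π̆ : Breve → ℤ
  π̆ (fin p)  = π p
  π̆ (ninf n) = n

  infix 4 _<̆_ _≤̆_
  data _<̆_ : Breve → Breve → Set where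
    by-π̆    : ∀ {a b} → π̆ a ℤ.< π̆ b → a <̆ b
    inf<fin : ∀ {n p} → n ≡ π p → ninf n <̆ fin p
    fin<fin : ∀ {x y} → π x ≡ π y → x <Γ y → fin x <̆ fin y

  _≤̆_ : Breve → Breve → Set
  a ≤̆ b = (a <̆ b) ⊎ (a ≡ b)

  infixl 6 _∘̆_
  _∘̆_ : Breve → Breve → Breve
  fin x  ∘̆ fin y  = fin (x + y)
  fin x  ∘̆ ninf m = ninf (π x ℤ.+ m)
  ninf n ∘̆ fin y  = ninf (n ℤ.+ π y)
  ninf n ∘̆ ninf m = ninf (n ℤ.+ m)

  0̆ : Breve
  0̆ = fin 0#

  IsPerp : Carrier → Breve → Breve → Set
  IsPerp γ β φ =
    (0̆ <̆ φ ∘̆ β ∘̆ fin γ) × (∀ φ' → 0̆ <̆ φ' ∘̆ β ∘̆ fin γ → φ ≤̆ φ')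

  private
    idem-ℤ : ∀ i → i ℤ.+ i ≡ i → i ≡ 0ℤ
    idem-ℤ i e = trans (sym (ℤP.+-identityʳ i))
                  (trans (cong (λ z → i ℤ.+ z) (sym (ℤP.+-inverseʳ i)))
                  (trans (sym (ℤP.+-assoc i i (ℤ.- i)))
                  (trans (cong (λ z → z ℤ.+ ℤ.- i) e) (ℤP.+-inverseʳ i))))

    π0 : π 0# ≡ 0ℤ
    π0 = idem-ℤ (π 0#) (trans (sym (π-hom 0# 0#)) (cong π (IG.identityˡ 0#)))

    π-neg : ∀ x → π (- x) ≡ ℤ.- π x
    π-neg x = ZP.inverseʳ-unique (π x) (π (- x))
                (trans (sym (π-hom x (- x))) (trans (cong π (IG.inverseʳ x)) π0))

    π-diff : ∀ x y → π x ≡ π y → π (y - x) ≡ 0ℤ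
    π-diff x y e = trans (π-hom y (- x))
                  (trans (cong (λ z → π y ℤ.+ z) (trans (π-neg x) (cong ℤ.-_ e)))
                         (ℤP.+-inverseʳ (π y)))

    idem-G : ∀ x → x + x ≡ x → x ≡ 0#
    idem-G x e = trans (sym (IG.identityʳ x))
                  (trans (cong (x +_) (sym (IG.inverseʳ x)))
                  (trans (sym (IG.assoc x x (- x)))
                  (trans (cong (_+ - x) e) (IG.inverseʳ x))))

    ι0 : ι 0ℤ ≡ 0#
    ι0 = idem-G (ι 0ℤ) (sym (ι-hom 0ℤ 0ℤ))

    ι-neg : ∀ k → ι (ℤ.- k) ≡ - ι k
    ι-neg k = GP.inverseʳ-unique (ι k) (ι (ℤ.- k))
                (trans (sym (ι-hom k (ℤ.- k))) (trans (cong ι (ℤP.+-inverseʳ k)) ι0))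

  cmpΓ : (x y : Carrier) → π x ≡ π y → (y <Γ x) ⊎ (y ≡ x) ⊎ (x <Γ y)
  cmpΓ x y e with ker⊆im (y - x) (π-diff x y e)
  ... | k , ek with ℤP.<-cmp 0ℤ k
  ... | tri< 0<k _ _ = inj₂ (inj₂ (by-ker e k 0<k ek))
  ... | tri≈ _ 0≡k _ = inj₂ (inj₁ (GP.x∙y⁻¹≈ε⇒x≈y y x
                          (trans (sym ek) (trans (cong ι (sym 0≡k)) ι0))))
  ... | tri> _ _ k<0 = inj₁ (by-ker (sym e) (ℤ.- k) (ℤP.neg-mono-< k<0)
                          (trans (ι-neg k) (trans (cong -_ ek) (GP.⁻¹-anti-homo‿- y x))))

  cmp : (a b : Breve) → (b ≤̆ a) ⊎ (a <̆ b)
  cmp a b with ℤP.<-cmp (π̆ a) (π̆ b)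
  ... | tri< lt _ _ = inj₂ (by-π̆ lt)
  ... | tri> _ _ gt = inj₁ (inj₁ (by-π̆ gt))
  cmp (ninf n) (ninf m) | tri≈ _ e _ = inj₁ (inj₂ (cong ninf (sym e)))
  cmp (ninf n) (fin p)  | tri≈ _ e _ = inj₂ (inf<fin e)
  cmp (fin p)  (ninf n) | tri≈ _ e _ = inj₁ (inj₁ (inf<fin (sym e)))
  cmp (fin x)  (fin y)  | tri≈ _ e _ with cmpΓ x y e
  ... | inj₁ y<x        = inj₁ (inj₁ (fin<fin (sym e) y<x))
  ... | inj₂ (inj₁ y≡x) = inj₁ (inj₂ (cong fin y≡x))
  ... | inj₂ (inj₂ x<y) = inj₂ (fin<fin e x<y)

  InR : Breve → Breve → Carrier → Set
  InR α β x = (fin x <̆ α) × (β ≤̆ fin x)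

  ValidY : Breve → Breve → (Carrier → Bool) → Set
  ValidY α β Y =
    (∀ y → Y y ≡ true → InR α β y) ×
    (∀ y y' → Y y ≡ true → Y y' ≡ true → π y ≡ π y' → y ≡ y') ×
    (∀ x → InR α β x → Σ Carrier (λ y → (Y y ≡ true) × (π y ≡ π x)))

  InT : Breve → Breve → (Carrier → Bool) → Carrier → Set
  InT α β Y x =
    InR α β x × Σ ℤ (λ k → (0ℤ ℤ.≤ k) × Σ Carrier (λ y → (Y y ≡ true) × (x ≡ ι k + y)))

  -- A ∼ T : finite symmetric difference (all disagreements lie in a finite list)
  Near : (Carrier → Bool) → (Carrier → Set) → Set
  Near A T = Σ (List Carrier) (λ L → ∀ x → ¬ (x ∈ L) →
               ((A x ≡ true → T x) × (T x → A x ≡ true)))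

  record Sub (α β : Breve) : Set where
    field
      A    : Carrier → Bool
      A⊆R  : ∀ x → A x ≡ true → InR α β x
      Y    : Carrier → Bool
      Yok  : ValidY α β Y
      near : Near A (InT α β Y)
  open Sub public

  -- elements of the torsor [α , β] (for α ≥ β):  d : τ → ℤ  with
  -- d(A₂) = d(A₁) + |A₂ ∖ A₁|  for A₁ ⊆ A₂
  record C (α β : Breve) : Set where
    field
      d   : Sub α β → ℤ
      law : ∀ (S₁ S₂ : Sub α β) →
            (∀ x → A S₁ x ≡ true → A S₂ x ≡ true) →
            (L : List Carrier) → Unique L →
            (∀ x → x ∈ L → (A S₂ x ≡ true) × (A S₁ x ≡ false)) →
            (∀ x → A S₂ x ≡ true → A S₁ x ≡ false → x ∈ L) →
            d S₂ ≡ d S₁ ℤ.+ (ℤ⁺ (length L))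
  open C public

  _≈C_ : ∀ {α β} → C α β → C α β → Set
  p ≈C q = ∀ S → d p S ≡ d q S

  shiftC : ∀ {α β} → ℤ → C α β → C α β
  shiftC a p = record
    { d   = λ S → d p S ℤ.+ a
    ; law = λ S₁ S₂ s L u h₁ h₂ →
        trans (cong (λ z → z ℤ.+ a) (law p S₁ S₂ s L u h₁ h₂))
        (trans (ℤP.+-assoc (d p S₁) (ℤ⁺ (length L)) a)
        (trans (cong (λ z → d p S₁ ℤ.+ z) (ℤP.+-comm (ℤ⁺ (length L)) a))
               (sym (ℤP.+-assoc (d p S₁) a (ℤ⁺ (length L)))))) }

  -- [α , β] for arbitrary α , β : C α β if α ≥ β, and [β , α]^* otherwise
  Ord : Breve → Breve → Set
  Ord α β = (β ≤̆ α) ⊎ (α <̆ β)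

  TorO : (α β : Breve) → Ord α β → Set
  TorO α β (inj₁ _) = C α β
  TorO α β (inj₂ _) = C β α

  Tor : Breve → Breve → Set
  Tor α β = TorO α β (cmp α β)

  actO : ∀ α β (o : Ord α β) → ℤ → TorO α β o → TorO α β o
  actO α β (inj₁ _) a p = shiftC a p
  actO α β (inj₂ _) a p = shiftC (ℤ.- a) p     -- opposite action on the dual

  act : ∀ α β → ℤ → Tor α β → Tor α β
  act α β = actO α β (cmp α β)

  eqO : ∀ α β (o : Ord α β) → TorO α β o → TorO α β o → Set
  eqO α β (inj₁ _) p q = p ≈C q
  eqO α β (inj₂ _) p q = p ≈C q

  _≈T_ : ∀ {α β} → Tor α β → Tor α β → Set
  _≈T_ {α} {β} = eqO α β (cmp α β)

  -- Canonical isomorphisms, given as their graphs.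

  UnitO : ∀ α (o : Ord α α) → TorO α α o → ℤ → Set
  UnitO α (inj₁ _) p k = ∀ (S : Sub α α) → (∀ x → A S x ≡ false) → d p S ≡ k
  UnitO α (inj₂ _) p k = ⊥

  Unit : ∀ α → Tor α α → ℤ → Set
  Unit α = UnitO α (cmp α α)

  -- α ≥ β ≥ δ :  (d₁ ⊗ d₂)(A₁ ⊔ A₂) = d₁(A₁) + d₂(A₂)
  Cat : ∀ {α β δ} → C α β → C β δ → C α δ → Set
  Cat p q r = ∀ S₁ S₂ S → (∀ x → A S x ≡ (A S₁ x ∨ A S₂ x)) →
              d r S ≡ d p S₁ ℤ.+ d q S₂

  -- graph of [α , β] ⊗ [β , δ] ≅ [α , δ] in every ordering of α , β , δ,
  -- the non-ordered cases being induced from Cat via the pairing P ⊗ P^* → ℤ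
  CompO : ∀ α β δ (o₁ : Ord α β) (o₂ : Ord β δ) (o₃ : Ord α δ) →
          TorO α β o₁ → TorO β δ o₂ → TorO α δ o₃ → Set
  CompO α β δ (inj₁ _) (inj₁ _) (inj₁ _) p q r = Cat {α} {β} {δ} p q r
  CompO α β δ (inj₁ _) (inj₂ _) (inj₁ _) p q r = Cat {α} {δ} {β} r q p
  CompO α β δ (inj₁ _) (inj₂ _) (inj₂ _) p q r = Cat {δ} {α} {β} r p q
  CompO α β δ (inj₂ _) (inj₁ _) (inj₁ _) p q r = Cat {β} {α} {δ} p r q
  CompO α β δ (inj₂ _) (inj₁ _) (inj₂ _) p q r = Cat {β} {δ} {α} q r p
  CompO α β δ (inj₂ _) (inj₂ _) (inj₂ _) p q r = Cat {δ} {β} {α} q p r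
  CompO α β δ (inj₁ _) (inj₁ _) (inj₂ _) p q r = ⊥
  CompO α β δ (inj₂ _) (inj₂ _) (inj₁ _) p q r = ⊥

  Comp : ∀ α β δ → Tor α β → Tor β δ → Tor α δ → Set
  Comp α β δ = CompO α β δ (cmp α β) (cmp β δ) (cmp α δ)

  Trans : ∀ (φ : Carrier) {α β α' β'} → C α β → C α' β' → Set
  Trans φ p p' = ∀ (S : Sub _ _) (S' : Sub _ _) →
                 (∀ x → A S' (φ + x) ≡ A S x) → d p' S' ≡ d p S

  TransO : ∀ φ α β (o : Ord α β) (o' : Ord (fin φ ∘̆ α) (fin φ ∘̆ β)) →
           TorO α β o → TorO (fin φ ∘̆ α) (fin φ ∘̆ β) o' → Set
  TransO φ α β (inj₁ _) (inj₁ _) p p' = Trans φ p p'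
  TransO φ α β (inj₂ _) (inj₂ _) p p' = Trans φ p p'
  TransO φ α β (inj₁ _) (inj₂ _) p p' = ⊥
  TransO φ α β (inj₂ _) (inj₁ _) p p' = ⊥

  TransT : ∀ φ α β → Tor α β → Tor (fin φ ∘̆ α) (fin φ ∘̆ β) → Set
  TransT φ α β = TransO φ α β (cmp α β) (cmp (fin φ ∘̆ α) (fin φ ∘̆ β))

{-# OPTIONS --safe #-}
-- The minimum defining β^{⊥(γ)} can be computed: with r z = -(z + γ) it is ι 1 + r b for
-- β = b ∈ Γ and (1 - n - π γ, -∞) for β = (n, -∞), so (1) and (2) are identities in Γ and ℤ.
-- The reflection r is an order-reversing involution of Γ with α > z ≥ β iff β^⊥ > r z ≥ α^⊥,
-- so it maps R_{α,β} onto R_{β^⊥,α^⊥}.  For α > β, ψ sends d ∈ [α,β] to A′ ↦ -d(R_{α,β} ∖ r⁻¹A′),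
-- an element of [β^⊥,α^⊥] = [α^⊥,β^⊥]^*: taking complements reverses inclusions, which makes
-- this a map of torsors for the dual action, and R_{α,δ} = R_{α,β} ⊔ R_{β,δ} makes it respect
-- composition.  When α = β both torsors are ℤ and ψ is the identity.  Translation by φ commutes
-- with complements and r (φ + z) = -φ + r z, which gives the square (4).

module Submission where

open import Defs
open import Algebra.Structures using (IsAbelianGroup)
import Algebra.Properties.AbelianGroup as AGP
open import Data.Bool using (Bool; true; false; not; _∧_; _∨_)
open import Data.Bool.Properties using (∨-identityʳ; ∧-zeroʳ)
open import Data.Empty using (⊥; ⊥-elim)
open import Data.Integer as ℤ using (ℤ; 0ℤ; 1ℤ; -1ℤ)
open import Data.Integer.Base using () renaming (+_ to ℤ⁺)
import Data.Integer.Properties as ℤP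
open import Data.Integer.Tactic.RingSolver using (solve-∀)
open import Data.List using (List; []; _∷_; map; _++_; length)
open import Data.List.Properties using (length-map)
open import Data.List.Membership.Propositional using (_∈_)
open import Data.List.Membership.Propositional.Properties using (∈-map⁺; ∈-map⁻; ∈-++⁺ˡ; ∈-++⁺ʳ)
open import Data.List.Relation.Unary.Any using (here)
open import Data.List.Relation.Unary.AllPairs using ([])
open import Data.List.Relation.Unary.Unique.Propositional using (Unique)
open import Data.List.Relation.Unary.Unique.Propositional.Properties using (map⁺)
import Data.Nat as ℕ
open import Data.Product using (Σ; _×_; _,_; proj₁; proj₂)
open import Data.Sum using (_⊎_; inj₁; inj₂; [_,_])
open import Relation.Binary.PropositionalEquality using (_≡_; refl; sym; trans; cong; cong₂; subst; subst₂; module ≡-Reasoning)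
open import Relation.Nullary using (Dec; yes; no; ¬_; does)
open import Relation.Nullary.Decidable using (dec-true; dec-false; _×-dec_)

true≢false : ¬ (true ≡ false)
true≢false ()

∧-true : ∀ {a b} → a ≡ true → b ≡ true → a ∧ b ≡ true
∧-true refl refl = refl

∧-true⁻ : ∀ {a b} → a ∧ b ≡ true → (a ≡ true) × (b ≡ true)
∧-true⁻ {true} {true} _ = refl , refl

∨-trueˡ : ∀ {a b} → a ≡ true → a ∨ b ≡ true
∨-trueˡ refl = refl

∨-trueʳ : ∀ {a b} → b ≡ true → a ∨ b ≡ true
∨-trueʳ {true} _ = refl
∨-trueʳ {false} e = e

∨-true⁻ : ∀ {a b} → a ∨ b ≡ true → (a ≡ true) ⊎ (b ≡ true)
∨-true⁻ {true} _ = inj₁ refl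
∨-true⁻ {false} e = inj₂ e

not-true⁻ : ∀ {a} → not a ≡ true → a ≡ false
not-true⁻ {false} _ = refl

not-false⁻ : ∀ {a} → not a ≡ false → a ≡ true
not-false⁻ {true} _ = refl

not-false : ∀ {a} → a ≡ false → not a ≡ true
not-false refl = refl

≢true⇒≡false : ∀ {a} → ¬ (a ≡ true) → a ≡ false
≢true⇒≡false {false} _ = refl
≢true⇒≡false {true} h = ⊥-elim (h refl)

does-true⁻ : ∀ {A : Set} (a? : Dec A) → does a? ≡ true → A
does-true⁻ (yes a) _ = a

does-false⁻ : ∀ {A : Set} (a? : Dec A) → does a? ≡ false → ¬ A
does-false⁻ (no ¬a) _ = ¬a

module ℤₚ = AGP ℤP.+-0-abelianGroup

0<x+y⇒-y<x : ∀ x y → 0ℤ ℤ.< x ℤ.+ y → ℤ.- y ℤ.< x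
0<x+y⇒-y<x x y 0<x+y = subst₂ ℤ._<_ (ℤP.+-identityˡ (ℤ.- y)) (ℤₚ.//-rightDividesʳ y x)
                                  (ℤP.+-monoˡ-< (ℤ.- y) 0<x+y)

neg-shift : ∀ {a b} n → a ≡ b ℤ.+ n → ℤ.- b ≡ ℤ.- a ℤ.+ n
neg-shift {b = b} n refl =
  sym (trans (cong (ℤ._+ n) (ℤP.neg-distrib-+ b n)) (ℤₚ.//-rightDividesˡ n (ℤ.- b)))

≤⇒<⊎≡ : ∀ {m n} → m ℤ.≤ n → (m ℤ.< n) ⊎ (m ≡ n)
≤⇒<⊎≡ {m} {n} m≤n with m ℤ.≟ n
... | yes m≡n = inj₂ m≡n
... | no m≢n = inj₁ (ℤP.≤∧≢⇒< m≤n m≢n)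

module Order (G : ExtGroup) where
  open WithGroup G
  module Γ = IsAbelianGroup isAbelianGroup
  module Γₚ = AGP bundle

  π-0# : π 0# ≡ 0ℤ
  π-0# = ℤₚ.identityʳ-unique (π 0#) (π 0#) (trans (sym (π-hom 0# 0#)) (cong π (Γ.identityʳ 0#)))

  π-neg : ∀ x → π (- x) ≡ ℤ.- π x
  π-neg x = ℤₚ.inverseʳ-unique (π x) (π (- x))
              (trans (sym (π-hom x (- x))) (trans (cong π (Γ.inverseʳ x)) π-0#))

  ι-0ℤ : ι 0ℤ ≡ 0#
  ι-0ℤ = Γₚ.identityʳ-unique (ι 0ℤ) (ι 0ℤ) (sym (ι-hom 0ℤ 0ℤ))

  π-ι+ : ∀ k x → π (ι k + x) ≡ π x
  π-ι+ k x = trans (π-hom (ι k) x) (trans (cong (ℤ._+ π x) (im⊆ker k)) (ℤP.+-identityˡ (π x)))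

  ι+-assoc : ∀ a b x → ι a + (ι b + x) ≡ ι (a ℤ.+ b) + x
  ι+-assoc a b x = trans (sym (Γ.assoc (ι a) (ι b) x)) (cong (_+ x) (sym (ι-hom a b)))

  +-swap : ∀ u v x → u + (v + x) ≡ v + (u + x)
  +-swap u v x = trans (sym (Γ.assoc u v x)) (trans (cong (_+ x) (Γ.comm u v)) (Γ.assoc v u x))

  ι≡-⇒≡ι+ : ∀ {x y k} → ι k ≡ y - x → y ≡ ι k + x
  ι≡-⇒≡ι+ {x} {y} e = trans (sym (Γₚ.//-rightDividesˡ x y)) (cong (_+ x) (sym e))

  ≡ι+⇒ι≡- : ∀ {x y k} → y ≡ ι k + x → ι k ≡ y - x
  ≡ι+⇒ι≡- {x} {k = k} e = sym (trans (cong (_- x) e) (Γₚ.//-rightDividesʳ x (ι k)))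

  sucΓ predΓ : Carrier → Carrier
  sucΓ x = ι 1ℤ + x
  predΓ x = ι -1ℤ + x

  predΓ-sucΓ : ∀ x → predΓ (sucΓ x) ≡ x
  predΓ-sucΓ x = trans (ι+-assoc -1ℤ 1ℤ x) (trans (cong (_+ x) ι-0ℤ) (Γ.identityˡ x))

  sucΓ-predΓ : ∀ x → sucΓ (predΓ x) ≡ x
  sucΓ-predΓ x = trans (ι+-assoc 1ℤ -1ℤ x) (trans (cong (_+ x) ι-0ℤ) (Γ.identityˡ x))

  π-sucΓ : ∀ x → π (sucΓ x) ≡ π x
  π-sucΓ = π-ι+ 1ℤ

  infix 4 _≤Γ_
  _≤Γ_ : Carrier → Carrier → Set
  x ≤Γ y = (x <Γ y) ⊎ (x ≡ y)

  ι-pos⇒<Γ : ∀ {x y} k → 0ℤ ℤ.< k → y ≡ ι k + x → x <Γ y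
  ι-pos⇒<Γ {x} k 0<k e = by-ker (sym (trans (cong π e) (π-ι+ k x))) k 0<k (≡ι+⇒ι≡- e)

  ι-nonneg⇒≤Γ : ∀ {x y} k → 0ℤ ℤ.≤ k → y ≡ ι k + x → x ≤Γ y
  ι-nonneg⇒≤Γ {x} ℤ.+0 _ e = inj₂ (sym (trans e (trans (cong (_+ x) ι-0ℤ) (Γ.identityˡ x))))
  ι-nonneg⇒≤Γ ℤ.+[1+ n ] _ e = inj₁ (ι-pos⇒<Γ _ (ℤ.+<+ ℕ.z<s) e)

  ≤Γ⇒ι-nonneg : ∀ {x y} → π x ≡ π y → x ≤Γ y → Σ ℤ (λ k → (0ℤ ℤ.≤ k) × (y ≡ ι k + x))
  ≤Γ⇒ι-nonneg {x} _ (inj₂ refl) = 0ℤ , ℤP.≤-refl , sym (trans (cong (_+ x) ι-0ℤ) (Γ.identityˡ x))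
  ≤Γ⇒ι-nonneg e (inj₁ (by-π p)) = ⊥-elim (ℤP.<-irrefl e p)
  ≤Γ⇒ι-nonneg _ (inj₁ (by-ker _ k 0<k d)) = k , ℤP.<⇒≤ 0<k , ι≡-⇒≡ι+ d

  <Γ-irrefl : ∀ {x} → ¬ (x <Γ x)
  <Γ-irrefl (by-π p) = ℤP.<-irrefl refl p
  <Γ-irrefl {x} (by-ker _ k 0<k d) =
    ℤP.<-irrefl (sym (ι-injective k 0ℤ (trans d (trans (Γ.inverseʳ x) (sym ι-0ℤ))))) 0<k

  <Γ-trans : ∀ {x y z} → x <Γ y → y <Γ z → x <Γ z
  <Γ-trans (by-π p) (by-π q) = by-π (ℤP.<-trans p q)
  <Γ-trans {x} (by-π p) (by-ker e _ _ _) = by-π (subst (π x ℤ.<_) e p)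
  <Γ-trans {z = z} (by-ker e _ _ _) (by-π q) = by-π (subst (ℤ._< π z) (sym e) q)
  <Γ-trans {x} (by-ker _ k₁ p₁ d₁) (by-ker _ k₂ p₂ d₂) =
    ι-pos⇒<Γ (k₂ ℤ.+ k₁) (ℤP.+-mono-< {0ℤ} p₂ p₁)
      (trans (ι≡-⇒≡ι+ d₂) (trans (cong (ι k₂ +_) (ι≡-⇒≡ι+ d₁)) (ι+-assoc k₂ k₁ x)))

  ≤-<Γ-trans : ∀ {x y z} → x ≤Γ y → y <Γ z → x <Γ z
  ≤-<Γ-trans (inj₁ p) q = <Γ-trans p q
  ≤-<Γ-trans (inj₂ refl) q = q

  ≤Γ-trans : ∀ {x y z} → x ≤Γ y → y ≤Γ z → x ≤Γ z
  ≤Γ-trans p (inj₁ q) = inj₁ (≤-<Γ-trans p q)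
  ≤Γ-trans p (inj₂ refl) = p

  ≤Γ-antisym : ∀ {x y} → x ≤Γ y → y ≤Γ x → x ≡ y
  ≤Γ-antisym (inj₂ e) _ = e
  ≤Γ-antisym (inj₁ _) (inj₂ e) = sym e
  ≤Γ-antisym (inj₁ p) (inj₁ q) = ⊥-elim (<Γ-irrefl (<Γ-trans p q))

  +-monoʳ-<Γ : ∀ u {x y} → x <Γ y → (u + x) <Γ (u + y)
  +-monoʳ-<Γ u {x} {y} (by-π p) =
    by-π (subst₂ ℤ._<_ (sym (π-hom u x)) (sym (π-hom u y)) (ℤP.+-monoʳ-< (π u) p))
  +-monoʳ-<Γ u {x} (by-ker _ k p d) = ι-pos⇒<Γ k p (trans (cong (u +_) (ι≡-⇒≡ι+ d)) (+-swap u (ι k) x))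

  +-monoˡ-<Γ : ∀ u {x y} → x <Γ y → (x + u) <Γ (y + u)
  +-monoˡ-<Γ u {x} {y} p = subst₂ _<Γ_ (Γ.comm u x) (Γ.comm u y) (+-monoʳ-<Γ u p)

  neg-mono-<Γ : ∀ {x y} → x <Γ y → (- y) <Γ (- x)
  neg-mono-<Γ {x} {y} (by-π p) = by-π (subst₂ ℤ._<_ (sym (π-neg y)) (sym (π-neg x)) (ℤP.neg-mono-< p))
  neg-mono-<Γ {x} {y} (by-ker _ k p d) = ι-pos⇒<Γ k p (sym (begin
    ι k + - y           ≡⟨ cong (λ w → ι k + - w) (ι≡-⇒≡ι+ d) ⟩
    ι k + - (ι k + x)   ≡⟨ cong (ι k +_) (sym (Γₚ.⁻¹-∙-comm (ι k) x)) ⟩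
    ι k + (- ι k + - x) ≡⟨ Γₚ.\\-leftDividesˡ (ι k) (- x) ⟩
    - x                 ∎))
    where open ≡-Reasoning

  +-monoʳ-≤Γ : ∀ u {x y} → x ≤Γ y → (u + x) ≤Γ (u + y)
  +-monoʳ-≤Γ u (inj₁ p) = inj₁ (+-monoʳ-<Γ u p)
  +-monoʳ-≤Γ u (inj₂ refl) = inj₂ refl

  +-monoˡ-≤Γ : ∀ u {x y} → x ≤Γ y → (x + u) ≤Γ (y + u)
  +-monoˡ-≤Γ u (inj₁ p) = inj₁ (+-monoˡ-<Γ u p)
  +-monoˡ-≤Γ u (inj₂ refl) = inj₂ refl

  neg-mono-≤Γ : ∀ {x y} → x ≤Γ y → (- y) ≤Γ (- x)
  neg-mono-≤Γ (inj₁ p) = inj₁ (neg-mono-<Γ p)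
  neg-mono-≤Γ (inj₂ refl) = inj₂ refl

  <Γ-sucΓ : ∀ x → x <Γ sucΓ x
  <Γ-sucΓ x = ι-pos⇒<Γ 1ℤ (ℤ.+<+ ℕ.z<s) refl

  <Γ⇒sucΓ≤Γ : ∀ {x y} → x <Γ y → sucΓ x ≤Γ y
  <Γ⇒sucΓ≤Γ {x} {y} (by-π p) = inj₁ (by-π (subst (ℤ._< π y) (sym (π-sucΓ x)) p))
  <Γ⇒sucΓ≤Γ {x} (by-ker _ ℤ.+[1+ n ] _ d) = ι-nonneg⇒≤Γ (ℤ.+ n) (ℤ.+≤+ ℕ.z≤n)
    (trans (ι≡-⇒≡ι+ d) (trans (sym (ι+-assoc 1ℤ (ℤ.+ n) x)) (+-swap (ι 1ℤ) (ι (ℤ.+ n)) x)))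
  <Γ⇒sucΓ≤Γ (by-ker _ ℤ.+0 (ℤ.+<+ ()) _)

  <̆⇒<Γ : ∀ {x y} → fin x <̆ fin y → x <Γ y
  <̆⇒<Γ (by-π̆ p) = by-π p
  <̆⇒<Γ (fin<fin _ q) = q

  <Γ⇒<̆ : ∀ {x y} → x <Γ y → fin x <̆ fin y
  <Γ⇒<̆ (by-π p) = by-π̆ p
  <Γ⇒<̆ q@(by-ker e _ _ _) = fin<fin e q

  ≤̆⇒≤Γ : ∀ {x y} → fin x ≤̆ fin y → x ≤Γ y
  ≤̆⇒≤Γ (inj₁ p) = inj₁ (<̆⇒<Γ p)
  ≤̆⇒≤Γ (inj₂ refl) = inj₂ refl

  ≤Γ⇒≤̆ : ∀ {x y} → x ≤Γ y → fin x ≤̆ fin y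
  ≤Γ⇒≤̆ (inj₁ p) = inj₁ (<Γ⇒<̆ p)
  ≤Γ⇒≤̆ (inj₂ refl) = inj₂ refl

  π̆-mono-≤ : ∀ {a b} → a <̆ b → π̆ a ℤ.≤ π̆ b
  π̆-mono-≤ (by-π̆ p) = ℤP.<⇒≤ p
  π̆-mono-≤ (inf<fin e) = ℤP.≤-reflexive e
  π̆-mono-≤ (fin<fin e _) = ℤP.≤-reflexive e

  <̆-irrefl : ∀ {a} → ¬ (a <̆ a)
  <̆-irrefl (by-π̆ p) = ℤP.<-irrefl refl p
  <̆-irrefl (fin<fin _ q) = <Γ-irrefl q

  <̆-trans : ∀ {a b c} → a <̆ b → b <̆ c → a <̆ c
  <̆-trans (by-π̆ p) q = by-π̆ (ℤP.<-≤-trans p (π̆-mono-≤ q))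
  <̆-trans {c = c} (inf<fin e) (by-π̆ q) = by-π̆ (subst (ℤ._< π̆ c) (sym e) q)
  <̆-trans (inf<fin e) (fin<fin e′ _) = inf<fin (trans e e′)
  <̆-trans {c = c} (fin<fin e _) (by-π̆ q) = by-π̆ (subst (ℤ._< π̆ c) (sym e) q)
  <̆-trans (fin<fin e p) (fin<fin e′ q) = fin<fin (trans e e′) (<Γ-trans p q)

  ≤-<̆-trans : ∀ {a b c} → a ≤̆ b → b <̆ c → a <̆ c
  ≤-<̆-trans (inj₁ p) q = <̆-trans p q
  ≤-<̆-trans (inj₂ refl) q = q

  <-≤̆-trans : ∀ {a b c} → a <̆ b → b ≤̆ c → a <̆ c
  <-≤̆-trans p (inj₁ q) = <̆-trans p q
  <-≤̆-trans p (inj₂ refl) = p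

  ≤̆-trans : ∀ {a b c} → a ≤̆ b → b ≤̆ c → a ≤̆ c
  ≤̆-trans p (inj₁ q) = inj₁ (≤-<̆-trans p q)
  ≤̆-trans p (inj₂ refl) = p

  ≤̆-antisym : ∀ {a b} → a ≤̆ b → b ≤̆ a → a ≡ b
  ≤̆-antisym (inj₂ e) _ = e
  ≤̆-antisym (inj₁ _) (inj₂ e) = sym e
  ≤̆-antisym (inj₁ p) (inj₁ q) = ⊥-elim (<̆-irrefl (<̆-trans p q))

  <⇒≱̆ : ∀ {a b} → a <̆ b → ¬ (b ≤̆ a)
  <⇒≱̆ p q = <̆-irrefl (<-≤̆-trans p q)

  ≤⇒ninf<̆fin : ∀ {n x} → n ℤ.≤ π x → ninf n <̆ fin x
  ≤⇒ninf<̆fin n≤πx with ≤⇒<⊎≡ n≤πx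
  ... | inj₁ lt = by-π̆ lt
  ... | inj₂ e = inf<fin e

  ≤⇒ninf≤̆ninf : ∀ {m n} → m ℤ.≤ n → ninf m ≤̆ ninf n
  ≤⇒ninf≤̆ninf m≤n with ≤⇒<⊎≡ m≤n
  ... | inj₁ lt = inj₁ (by-π̆ lt)
  ... | inj₂ e = inj₂ (cong ninf e)

  fin<̆ninf⇒< : ∀ {x n} → fin x <̆ ninf n → π x ℤ.< n
  fin<̆ninf⇒< (by-π̆ p) = p

  ninf≤̆fin⇒≤ : ∀ {n x} → ninf n ≤̆ fin x → n ℤ.≤ π x
  ninf≤̆fin⇒≤ (inj₁ p) = π̆-mono-≤ p

  0̆<ninf⇒0< : ∀ {n} → 0̆ <̆ ninf n → 0ℤ ℤ.< n
  0̆<ninf⇒0< {n} (by-π̆ p) = subst (ℤ._< n) π-0# p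

  π̆-translate : ∀ u a → π̆ (fin u ∘̆ a) ≡ π u ℤ.+ π̆ a
  π̆-translate u (fin x) = π-hom u x
  π̆-translate u (ninf n) = refl

  translate-<̆ : ∀ u {a b} → a <̆ b → fin u ∘̆ a <̆ fin u ∘̆ b
  translate-<̆ u {a} {b} (by-π̆ p) =
    by-π̆ (subst₂ ℤ._<_ (sym (π̆-translate u a)) (sym (π̆-translate u b)) (ℤP.+-monoʳ-< (π u) p))
  translate-<̆ u {b = fin x} (inf<fin e) = inf<fin (trans (cong (ℤ._+_ (π u)) e) (sym (π-hom u x)))
  translate-<̆ u {fin x} {fin y} (fin<fin e q) =
    fin<fin (trans (π-hom u x) (trans (cong (ℤ._+_ (π u)) e) (sym (π-hom u y)))) (+-monoʳ-<Γ u q)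

  translate-≤̆ : ∀ u {a b} → a ≤̆ b → fin u ∘̆ a ≤̆ fin u ∘̆ b
  translate-≤̆ u (inj₁ p) = inj₁ (translate-<̆ u p)
  translate-≤̆ u (inj₂ refl) = inj₂ refl

  translate-neg-translate : ∀ u a → fin (- u) ∘̆ (fin u ∘̆ a) ≡ a
  translate-neg-translate u (fin x) = cong fin (Γₚ.\\-leftDividesʳ u x)
  translate-neg-translate u (ninf n) =
    cong ninf (trans (cong (ℤ._+ (π u ℤ.+ n)) (π-neg u)) (ℤₚ.\\-leftDividesʳ (π u) n))

  translate-<̆⁻ : ∀ u {a b} → fin u ∘̆ a <̆ fin u ∘̆ b → a <̆ b
  translate-<̆⁻ u {a} {b} p =
    subst₂ _<̆_ (translate-neg-translate u a) (translate-neg-translate u b) (translate-<̆ (- u) p)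

  translate-≤̆⁻ : ∀ u {a b} → fin u ∘̆ a ≤̆ fin u ∘̆ b → a ≤̆ b
  translate-≤̆⁻ u {a} {b} p =
    subst₂ _≤̆_ (translate-neg-translate u a) (translate-neg-translate u b) (translate-≤̆ (- u) p)

  _<̆?_ : ∀ a b → Dec (a <̆ b)
  a <̆? b with cmp a b
  ... | inj₁ b≤a = no (λ a<b → <⇒≱̆ a<b b≤a)
  ... | inj₂ a<b = yes a<b

  _≤̆?_ : ∀ a b → Dec (a ≤̆ b)
  a ≤̆? b with cmp b a
  ... | inj₁ a≤b = yes a≤b
  ... | inj₂ b<a = no (<⇒≱̆ b<a)

  inR? : ∀ α β x → Dec (InR α β x)
  inR? α β x = (fin x <̆? α) ×-dec (β ≤̆? fin x)

  -- Opaque so that `with` and `rewrite` can abstract over membership tests.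
  opaque
    isInR : Breve → Breve → Carrier → Bool
    isInR α β x = does (inR? α β x)

    isInR-true : ∀ {α β x} → InR α β x → isInR α β x ≡ true
    isInR-true {α} {β} {x} = dec-true (inR? α β x)

    isInR-false : ∀ {α β x} → ¬ InR α β x → isInR α β x ≡ false
    isInR-false {α} {β} {x} = dec-false (inR? α β x)

    isInR-true⁻ : ∀ {α β x} → isInR α β x ≡ true → InR α β x
    isInR-true⁻ {α} {β} {x} = does-true⁻ (inR? α β x)

    isInR-false⁻ : ∀ {α β x} → isInR α β x ≡ false → ¬ InR α β x
    isInR-false⁻ {α} {β} {x} = does-false⁻ (inR? α β x)

  InR-empty : ∀ {α β x} → β ≡ α → ¬ InR α β x
  InR-empty refl (x<α , α≤x) = <⇒≱̆ x<α α≤x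

  InR-translate : ∀ u {α β x} → InR α β x → InR (fin u ∘̆ α) (fin u ∘̆ β) (u + x)
  InR-translate u (x<α , β≤x) = translate-<̆ u x<α , translate-≤̆ u β≤x

  InR-translate⁻ : ∀ u {α β x} → InR (fin u ∘̆ α) (fin u ∘̆ β) (u + x) → InR α β x
  InR-translate⁻ u {x = x} (x<α , β≤x) = translate-<̆⁻ u {fin x} x<α , translate-≤̆⁻ u {b = fin x} β≤x

  isInR-translate : ∀ u α β x → isInR (fin u ∘̆ α) (fin u ∘̆ β) (u + x) ≡ isInR α β x
  isInR-translate u α β x with inR? α β x
  ... | yes x∈R = trans (isInR-true (InR-translate u x∈R)) (sym (isInR-true x∈R))
  ... | no x∉R = trans (isInR-false (λ ux∈R → x∉R (InR-translate⁻ u ux∈R))) (sym (isInR-false x∉R))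

module Perp (G : ExtGroup) (γ : ExtGroup.Carrier G) where
  open WithGroup G
  open Order G

  r : Carrier → Carrier
  r z = - (z + γ)

  ρ : ℤ → ℤ
  ρ n = ℤ.- (n ℤ.+ π γ)

  orth : Breve → Breve
  orth (fin b) = fin (sucΓ (r b))
  orth (ninf m) = ninf (ℤ.suc (ρ m))

  π-r : ∀ z → π (r z) ≡ ρ (π z)
  π-r z = trans (π-neg (z + γ)) (cong ℤ.-_ (π-hom z γ))

  r-involutive : ∀ z → r (r z) ≡ z
  r-involutive z = begin
    - (- (z + γ) + γ)  ≡⟨ sym (Γₚ.⁻¹-∙-comm (- (z + γ)) γ) ⟩
    - - (z + γ) - γ    ≡⟨ cong (_- γ) (Γₚ.⁻¹-involutive (z + γ)) ⟩
    (z + γ) - γ        ≡⟨ Γₚ.//-rightDividesʳ γ z ⟩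
    z                  ∎
    where open ≡-Reasoning

  r-injective : ∀ {x y} → r x ≡ r y → x ≡ y
  r-injective {x} {y} e = trans (sym (r-involutive x)) (trans (cong r e) (r-involutive y))

  r-+ : ∀ u z → r (u + z) ≡ - u + r z
  r-+ u z = trans (cong -_ (Γ.assoc u z γ)) (sym (Γₚ.⁻¹-∙-comm u (z + γ)))

  π-r-r : ∀ {x y} → π x ≡ π (r y) → π (r x) ≡ π y
  π-r-r {x} {y} e = trans (π-r x) (trans (cong ρ e) (trans (sym (π-r (r y))) (cong π (r-involutive y))))

  π-r-cancel : ∀ {x y} → π (r x) ≡ π (r y) → π x ≡ π y
  π-r-cancel {x} e = trans (cong π (sym (r-involutive x))) (π-r-r e)

  r-anti-<Γ : ∀ {x y} → x <Γ y → r y <Γ r x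
  r-anti-<Γ p = neg-mono-<Γ (+-monoˡ-<Γ γ p)

  r-anti-≤Γ : ∀ {x y} → x ≤Γ y → r y ≤Γ r x
  r-anti-≤Γ p = neg-mono-≤Γ (+-monoˡ-≤Γ γ p)

  ρ-anti-< : ∀ {m n} → m ℤ.< n → ρ n ℤ.< ρ m
  ρ-anti-< p = ℤP.neg-mono-< (ℤP.+-monoˡ-< (π γ) p)

  ρ-anti-≤ : ∀ {m n} → m ℤ.≤ n → ρ n ℤ.≤ ρ m
  ρ-anti-≤ p = ℤP.neg-mono-≤ (ℤP.+-monoˡ-≤ (π γ) p)

  <̆⇒orth≤̆ : ∀ {z a} → fin z <̆ a → orth a ≤̆ fin (r z)
  <̆⇒orth≤̆ {z} {fin a} p = ≤Γ⇒≤̆ (subst (sucΓ (r a) ≤Γ_) (Γₚ.\\-leftDividesˡ (ι 1ℤ) (r z))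
    (+-monoʳ-≤Γ (ι 1ℤ) (subst (r a ≤Γ_) (r-+ (ι 1ℤ) z) (r-anti-≤Γ (<Γ⇒sucΓ≤Γ (<̆⇒<Γ p))))))
  <̆⇒orth≤̆ {z} {ninf m} p = inj₁ (≤⇒ninf<̆fin (subst (ℤ.suc (ρ m) ℤ.≤_) (sym (π-r z))
    (ℤP.i<j⇒suc[i]≤j (ρ-anti-< (fin<̆ninf⇒< p)))))

  ≤̆⇒<̆orth : ∀ {z a} → a ≤̆ fin z → fin (r z) <̆ orth a
  ≤̆⇒<̆orth {z} {fin b} q = <Γ⇒<̆ (≤-<Γ-trans (r-anti-≤Γ (≤̆⇒≤Γ q)) (<Γ-sucΓ (r b)))
  ≤̆⇒<̆orth {z} {ninf m} q = by-π̆ (subst (ℤ._< ℤ.suc (ρ m)) (sym (π-r z))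
    (ℤP.≤-<-trans (ρ-anti-≤ (ninf≤̆fin⇒≤ q)) (ℤP.suc[i]≤j⇒i<j ℤP.≤-refl)))

  orth≤̆⇒<̆ : ∀ {z a} → orth a ≤̆ fin z → fin (r z) <̆ a
  orth≤̆⇒<̆ {z} {a} q with cmp (fin (r z)) a
  ... | inj₂ p = p
  ... | inj₁ a≤rz = ⊥-elim (<⇒≱̆ (subst (λ w → fin w <̆ orth a) (r-involutive z) (≤̆⇒<̆orth a≤rz)) q)

  <̆orth⇒≤̆ : ∀ {z a} → fin z <̆ orth a → a ≤̆ fin (r z)
  <̆orth⇒≤̆ {z} {a} p with cmp (fin (r z)) a
  ... | inj₁ a≤rz = a≤rz
  ... | inj₂ rz<a = ⊥-elim (<⇒≱̆ p (subst (λ w → orth a ≤̆ fin w) (r-involutive z) (<̆⇒orth≤̆ rz<a)))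

  orth-anti-<̆ : ∀ {a b} → b <̆ a → orth a <̆ orth b
  orth-anti-<̆ {b = fin z} p = ≤-<̆-trans (<̆⇒orth≤̆ p) (<Γ⇒<̆ (<Γ-sucΓ (r z)))
  orth-anti-<̆ {fin w} {ninf m} p =
    by-π̆ (subst (ℤ._< ℤ.suc (ρ m)) (sym (π-sucΓ (r w))) (fin<̆ninf⇒< (≤̆⇒<̆orth {w} (inj₁ p))))
  orth-anti-<̆ {ninf n} {ninf m} (by-π̆ p) = by-π̆ (ℤP.+-monoʳ-< 1ℤ (ρ-anti-< p))

  InR-reflect : ∀ {α β z} → InR α β z → InR (orth β) (orth α) (r z)
  InR-reflect (z<α , β≤z) = ≤̆⇒<̆orth β≤z , <̆⇒orth≤̆ z<α

  InR-reflect⁻ : ∀ {α β z} → InR (orth β) (orth α) z → InR α β (r z)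
  InR-reflect⁻ (z<orthβ , orthα≤z) = orth≤̆⇒<̆ orthα≤z , <̆orth⇒≤̆ z<orthβ

  orth-positive : ∀ β → 0̆ <̆ orth β ∘̆ β ∘̆ fin γ
  orth-positive (fin b) = <Γ⇒<̆ (ι-pos⇒<Γ 1ℤ (ℤ.+<+ ℕ.z<s) (begin
    ((ι 1ℤ + r b) + b) + γ  ≡⟨ Γ.assoc _ b γ ⟩
    (ι 1ℤ + r b) + (b + γ)  ≡⟨ Γ.assoc (ι 1ℤ) (r b) (b + γ) ⟩
    ι 1ℤ + (r b + (b + γ))  ≡⟨ cong (ι 1ℤ +_) (Γ.inverseˡ (b + γ)) ⟩
    ι 1ℤ + 0#              ∎))
    where open ≡-Reasoning
  orth-positive (ninf m) = by-π̆ (subst₂ ℤ._<_ (sym π-0#)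
    (sym (trans (ℤP.+-assoc (ℤ.suc (ρ m)) m (π γ)) (ℤₚ.//-rightDividesˡ (m ℤ.+ π γ) 1ℤ)))
    (ℤ.+<+ ℕ.z<s))

  private
    positive⇒ρ< : ∀ x m → 0̆ <̆ ninf ((x ℤ.+ m) ℤ.+ π γ) → ρ m ℤ.< x
    positive⇒ρ< x m h = 0<x+y⇒-y<x x (m ℤ.+ π γ) (subst (0ℤ ℤ.<_) (ℤP.+-assoc x m (π γ)) (0̆<ninf⇒0< h))

  orth-minimal : ∀ β φ → 0̆ <̆ φ ∘̆ β ∘̆ fin γ → orth β ≤̆ φ
  orth-minimal (fin b) (fin f) h = ≤Γ⇒≤̆ (subst₂ _≤Γ_ (cong (_+ r b) (Γ.identityʳ (ι 1ℤ))) (begin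
    ((f + b) + γ) + r b  ≡⟨ cong (_+ r b) (Γ.assoc f b γ) ⟩
    (f + (b + γ)) + r b  ≡⟨ Γₚ.//-rightDividesʳ (b + γ) f ⟩
    f                    ∎) (+-monoˡ-≤Γ (r b) (<Γ⇒sucΓ≤Γ (<̆⇒<Γ h))))
    where open ≡-Reasoning
  orth-minimal (fin b) (ninf n) h =
    inj₁ (by-π̆ (subst (ℤ._< n) (sym (trans (π-sucΓ (r b)) (π-r b))) (positive⇒ρ< n (π b) h)))
  orth-minimal (ninf m) (fin f) h = inj₁ (≤⇒ninf<̆fin (ℤP.i<j⇒suc[i]≤j (positive⇒ρ< (π f) m h)))
  orth-minimal (ninf m) (ninf n) h = ≤⇒ninf≤̆ninf (ℤP.i<j⇒suc[i]≤j (positive⇒ρ< n m h))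

  perp-unique : ∀ {β φ} → IsPerp γ β φ → φ ≡ orth β
  perp-unique {β} {φ} (pos , min) = ≤̆-antisym (min (orth β) (orth-positive β)) (orth-minimal β φ pos)

module PerpLaws (G : ExtGroup) where
  open WithGroup G
  open Order G
  open Perp G using (orth; r-+)

  orth-translate : ∀ φ γ α → orth γ (fin φ ∘̆ α) ≡ fin (- φ) ∘̆ orth γ α
  orth-translate φ γ (fin a) =
    cong fin (trans (cong sucΓ (r-+ γ φ a)) (sym (+-swap (- φ) (ι 1ℤ) (Perp.r G γ a))))
  orth-translate φ γ (ninf m) =
    cong ninf (trans (shift (π φ) m (π γ)) (cong (ℤ._+ _) (sym (π-neg φ))))
    where
      shift : ∀ f m c → 1ℤ ℤ.+ ℤ.- ((f ℤ.+ m) ℤ.+ c) ≡ ℤ.- f ℤ.+ (1ℤ ℤ.+ ℤ.- (m ℤ.+ c))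
      shift = solve-∀

  orth-+ : ∀ γ₁ γ₂ β → orth (γ₁ + γ₂) β ≡ orth γ₁ (fin γ₂ ∘̆ β)
  orth-+ γ₁ γ₂ (fin b) = cong (λ x → fin (sucΓ (- x))) (begin
    b + (γ₁ + γ₂)  ≡⟨ cong (b +_) (Γ.comm γ₁ γ₂) ⟩
    b + (γ₂ + γ₁)  ≡⟨ sym (Γ.assoc b γ₂ γ₁) ⟩
    (b + γ₂) + γ₁  ≡⟨ cong (_+ γ₁) (Γ.comm b γ₂) ⟩
    (γ₂ + b) + γ₁  ∎)
    where open ≡-Reasoning
  orth-+ γ₁ γ₂ (ninf m) = cong (λ k → ninf (ℤ.suc (ℤ.- k)))
    (trans (cong (ℤ._+_ m) (π-hom γ₁ γ₂)) (rearrange m (π γ₁) (π γ₂)))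
    where
      rearrange : ∀ m a b → m ℤ.+ (a ℤ.+ b) ≡ (b ℤ.+ m) ℤ.+ a
      rearrange = solve-∀

  orth-+-translate : ∀ γ₁ γ₂ β → orth (γ₁ + γ₂) β ≡ fin (- γ₂) ∘̆ orth γ₁ β
  orth-+-translate γ₁ γ₂ β = trans (orth-+ γ₁ γ₂ β) (orth-translate γ₂ γ₁ β)

module Torsors (G : ExtGroup) where
  open WithGroup G
  open Order G

  Y⊆R : ∀ {α β} (S : Sub α β) y → Y S y ≡ true → InR α β y
  Y⊆R S = proj₁ (Yok S)

  Y-unique : ∀ {α β} (S : Sub α β) y y′ → Y S y ≡ true → Y S y′ ≡ true → π y ≡ π y′ → y ≡ y′
  Y-unique S = proj₁ (proj₂ (Yok S))

  Y-meets : ∀ {α β} (S : Sub α β) x → InR α β x → Σ Carrier (λ y → (Y S y ≡ true) × (π y ≡ π x))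
  Y-meets S = proj₂ (proj₂ (Yok S))

  exceptions : ∀ {α β} → Sub α β → List Carrier
  exceptions S = proj₁ (near S)

  near-at : ∀ {α β} (S : Sub α β) x → ¬ (x ∈ exceptions S) →
            (A S x ≡ true → InT α β (Y S) x) × (InT α β (Y S) x → A S x ≡ true)
  near-at S = proj₂ (near S)

  module _ {α β : Breve} {Y : Carrier → Bool}
           (unique : ∀ y y′ → Y y ≡ true → Y y′ ≡ true → π y ≡ π y′ → y ≡ y′) where

    InT⇒≥ : ∀ {y z} → Y y ≡ true → π y ≡ π z → InT α β Y z → y ≤Γ z
    InT⇒≥ {y} {z} Yy πy≡πz (_ , k , 0≤k , y′ , Yy′ , z≡ky′) = ι-nonneg⇒≤Γ k 0≤k
      (subst (λ w → z ≡ ι k + w)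
             (unique y′ y Yy′ Yy (trans (sym (trans (cong π z≡ky′) (π-ι+ k y′))) (sym πy≡πz)))
             z≡ky′)

  ≥⇒InT : ∀ {α β Y y z} → Y y ≡ true → InR α β z → π y ≡ π z → y ≤Γ z → InT α β Y z
  ≥⇒InT Yy z∈R πy≡πz y≤z with ≤Γ⇒ι-nonneg πy≡πz y≤z
  ... | k , 0≤k , z≡ky = z∈R , k , 0≤k , _ , Yy , z≡ky

  emptySub : ∀ α β → β ≡ α → Sub α β
  emptySub α β β≡α = record
    { A = λ _ → false ; A⊆R = λ _ () ; Y = λ _ → false
    ; Yok = (λ _ ()) , (λ _ _ ()) , (λ x x∈R → ⊥-elim (InR-empty β≡α x∈R))
    ; near = [] , λ x _ → (λ ()) , (λ x∈T → ⊥-elim (InR-empty β≡α (proj₁ x∈T))) }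

  A-empty : ∀ {α} (S : Sub α α) x → A S x ≡ false
  A-empty S x = ≢true⇒≡false (λ e → InR-empty refl (A⊆R S x e))

  InR-split : ∀ {α δ t} β → InR α δ t → InR α β t ⊎ InR β δ t
  InR-split {t = t} β (t<α , δ≤t) with cmp (fin t) β
  ... | inj₁ β≤t = inj₁ (t<α , β≤t)
  ... | inj₂ t<β = inj₂ (t<β , δ≤t)

  InR-⊆ˡ : ∀ {α β δ t} → δ ≤̆ β → InR α β t → InR α δ t
  InR-⊆ˡ δ≤β (t<α , β≤t) = t<α , ≤̆-trans δ≤β β≤t

  InR-⊆ʳ : ∀ {α β δ t} → β ≤̆ α → InR β δ t → InR α δ t
  InR-⊆ʳ β≤α (t<β , δ≤t) = <-≤̆-trans t<β β≤α , δ≤t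

  InR-disjoint : ∀ {α β δ t} → InR α β t → ¬ InR β δ t
  InR-disjoint (_ , β≤t) (t<β , _) = <⇒≱̆ t<β β≤t

module Translation (G : ExtGroup) where
  open WithGroup G
  open Order G
  open Torsors G

  untranslateSub : ∀ f α β → Sub (fin f ∘̆ α) (fin f ∘̆ β) → Sub α β
  untranslateSub f α β S = record
    { A = λ x → A S (f + x)
    ; A⊆R = λ x e → InR-translate⁻ f (A⊆R S (f + x) e)
    ; Y = λ x → Y S (f + x)
    ; Yok = (λ y e → InR-translate⁻ f (Y⊆R S (f + y) e)) , Y-unique′ , Y-meets′
    ; near = map ((- f) +_) (exceptions S) , λ x x∉ → to x x∉ , from x x∉ }
    where
      Y-unique′ : ∀ y₁ y₂ → Y S (f + y₁) ≡ true → Y S (f + y₂) ≡ true → π y₁ ≡ π y₂ → y₁ ≡ y₂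
      Y-unique′ y₁ y₂ e₁ e₂ πy₁≡πy₂ = Γₚ.∙-cancelˡ f y₁ y₂ (Y-unique S (f + y₁) (f + y₂) e₁ e₂
        (trans (π-hom f y₁) (trans (cong (ℤ._+_ (π f)) πy₁≡πy₂) (sym (π-hom f y₂)))))

      Y-meets′ : ∀ x → InR α β x → Σ Carrier (λ y → (Y S (f + y) ≡ true) × (π y ≡ π x))
      Y-meets′ x x∈R with Y-meets S (f + x) (InR-translate f x∈R)
      ... | y , Yy , πy≡πfx = - f + y , subst (λ w → Y S w ≡ true) (sym (Γₚ.\\-leftDividesˡ f y)) Yy ,
        trans (π-hom (- f) y) (trans (cong (ℤ._+_ (π (- f))) πy≡πfx)
          (trans (sym (π-hom (- f) (f + x))) (cong π (Γₚ.\\-leftDividesʳ f x))))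

      fx∉ : ∀ x → ¬ (x ∈ map ((- f) +_) (exceptions S)) → ¬ (f + x ∈ exceptions S)
      fx∉ x x∉ m = x∉ (subst (_∈ map ((- f) +_) (exceptions S)) (Γₚ.\\-leftDividesʳ f x) (∈-map⁺ ((- f) +_) m))

      to : ∀ x → ¬ (x ∈ map ((- f) +_) (exceptions S)) → A S (f + x) ≡ true → InT α β (λ x → Y S (f + x)) x
      to x x∉ e with proj₁ (near-at S (f + x) (fx∉ x x∉)) e
      ... | fx∈R , k , 0≤k , y , Yy , fx≡ky = InR-translate⁻ f fx∈R , k , 0≤k , - f + y ,
        subst (λ w → Y S w ≡ true) (sym (Γₚ.\\-leftDividesˡ f y)) Yy ,
        trans (sym (Γₚ.\\-leftDividesʳ f x)) (trans (cong ((- f) +_) fx≡ky) (+-swap (- f) (ι k) y))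

      from : ∀ x → ¬ (x ∈ map ((- f) +_) (exceptions S)) → InT α β (λ x → Y S (f + x)) x → A S (f + x) ≡ true
      from x x∉ (x∈R , k , 0≤k , y , Yfy , x≡ky) = proj₂ (near-at S (f + x) (fx∉ x x∉))
        (InR-translate f x∈R , k , 0≤k , f + y , Yfy , trans (cong (f +_) x≡ky) (+-swap f (ι k) y))

  -- TransO with arbitrary target endpoints, so that it can be transported along equations between them.
  TransAt : ∀ f a b a′ b′ (o : Ord a b) (o′ : Ord a′ b′) → TorO a b o → TorO a′ b′ o′ → Set
  TransAt f a b a′ b′ (inj₁ _) (inj₁ _) u v = Trans f u v
  TransAt f a b a′ b′ (inj₂ _) (inj₂ _) u v = Trans f u v
  TransAt f a b a′ b′ (inj₁ _) (inj₂ _) u v = ⊥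
  TransAt f a b a′ b′ (inj₂ _) (inj₁ _) u v = ⊥

  TransTor : ∀ f a b a′ b′ → Tor a b → Tor a′ b′ → Set
  TransTor f a b a′ b′ = TransAt f a b a′ b′ (cmp a b) (cmp a′ b′)

  TransO⇒TransAt : ∀ f a b (o : Ord a b) (o′ : Ord (fin f ∘̆ a) (fin f ∘̆ b)) u v →
                   TransO f a b o o′ u v → TransAt f a b (fin f ∘̆ a) (fin f ∘̆ b) o o′ u v
  TransO⇒TransAt f a b (inj₁ _) (inj₁ _) u v h = h
  TransO⇒TransAt f a b (inj₂ _) (inj₂ _) u v h = h

  TransAt-unique : ∀ f a b (o : Ord a b) (o′ : Ord (fin f ∘̆ a) (fin f ∘̆ b)) u v v′ →
                   TransAt f a b (fin f ∘̆ a) (fin f ∘̆ b) o o′ u v →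
                   TransAt f a b (fin f ∘̆ a) (fin f ∘̆ b) o o′ u v′ → eqO (fin f ∘̆ a) (fin f ∘̆ b) o′ v v′
  TransAt-unique f a b (inj₁ _) (inj₁ _) u v v′ h h′ S =
    trans (h (untranslateSub f a b S) S (λ _ → refl)) (sym (h′ (untranslateSub f a b S) S (λ _ → refl)))
  TransAt-unique f a b (inj₂ _) (inj₂ _) u v v′ h h′ S =
    trans (h (untranslateSub f b a S) S (λ _ → refl)) (sym (h′ (untranslateSub f b a S) S (λ _ → refl)))

  TransTor-substʳ : ∀ f a b {a′ b′ a″ b″} (e₁ : a′ ≡ a″) (e₂ : b′ ≡ b″) u v →
                    TransTor f a b a′ b′ u v → TransTor f a b a″ b″ u (subst₂ Tor e₁ e₂ v)
  TransTor-substʳ f a b refl refl u v h = h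

  TransTor-substˡ : ∀ f {a b a₀ b₀} a′ b′ (e₁ : a ≡ a₀) (e₂ : b ≡ b₀) u v →
                    TransTor f a b a′ b′ u v → TransTor f a₀ b₀ a′ b′ (subst₂ Tor e₁ e₂ u) v
  TransTor-substˡ f a′ b′ refl refl u v h = h

module Reflection (G : ExtGroup) (γ : ExtGroup.Carrier G) where
  open WithGroup G
  open Order G
  open Torsors G
  open Translation G
  open Perp G γ

  top : Breve → List Carrier
  top (fin a) = predΓ a ∷ []
  top (ninf _) = []

  ¬InR-sucΓ⇒top : ∀ {α β u} → InR α β u → ¬ InR α β (sucΓ u) → u ∈ top α
  ¬InR-sucΓ⇒top {ninf n} {u = u} (u<α , β≤u) ¬su∈R =
    ⊥-elim (¬su∈R (by-π̆ (subst (ℤ._< n) (sym (π-sucΓ u)) (fin<̆ninf⇒< u<α)) ,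
                   inj₁ (≤-<̆-trans β≤u (<Γ⇒<̆ (<Γ-sucΓ u)))))
  ¬InR-sucΓ⇒top {fin a} {u = u} (u<α , β≤u) ¬su∈R with <Γ⇒sucΓ≤Γ (<̆⇒<Γ u<α)
  ... | inj₁ su<a = ⊥-elim (¬su∈R (<Γ⇒<̆ su<a , inj₁ (≤-<̆-trans β≤u (<Γ⇒<̆ (<Γ-sucΓ u)))))
  ... | inj₂ su≡a = here (trans (sym (predΓ-sucΓ u)) (cong predΓ su≡a))

  A-outside : ∀ {α β} (S : Sub (orth β) (orth α)) {t} → ¬ InR α β t → A S (r t) ≡ false
  A-outside {α} {β} S {t} t∉R =
    ≢true⇒≡false (λ e → t∉R (subst (InR α β) (r-involutive t) (InR-reflect⁻ (A⊆R S (r t) e))))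

  module Reflect (α β : Breve) (S′ : Sub (orth β) (orth α)) where

    reflA : Carrier → Bool
    reflA z = isInR α β z ∧ not (A S′ (r z))

    -- Over a point y′ of Y S′, the complement of {z ≥ y′} reflects to {z > r y′}, which starts at
    -- sucΓ (r y′) unless r y′ is the last point of R in its fibre.
    reflY : Carrier → Bool
    reflY z = isInR α β z ∧ (Y S′ (r (predΓ z)) ∨ (not (isInR α β (sucΓ z)) ∧ Y S′ (r z)))

    data Over (y u : Carrier) : Set where
      above  : u ≡ sucΓ (r y) → InR α β u → Over y u
      at-top : u ≡ r y → ¬ InR α β (sucΓ u) → Over y u

    Over-π : ∀ {y u} → Over y u → π u ≡ π (r y)
    Over-π {y} (above refl _) = π-sucΓ (r y)
    Over-π (at-top refl _) = refl

    Over-unique : ∀ {y u₁ u₂} → Over y u₁ → Over y u₂ → u₁ ≡ u₂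
    Over-unique (above refl _) (above refl _) = refl
    Over-unique (at-top refl _) (at-top refl _) = refl
    Over-unique (above refl su∈R) (at-top refl ¬su∈R) = ⊥-elim (¬su∈R su∈R)
    Over-unique (at-top refl ¬su∈R) (above refl su∈R) = ⊥-elim (¬su∈R su∈R)

    Over-≤Γ : ∀ {y u z} → Over y u → r y <Γ z → u ≤Γ z
    Over-≤Γ (above refl _) ry<z = <Γ⇒sucΓ≤Γ ry<z
    Over-≤Γ (at-top refl _) ry<z = inj₁ ry<z

    Over-squeeze : ∀ {y u z} → Over y u → InR α β z → u ≤Γ z → z ≤Γ r y → z ∈ top α
    Over-squeeze {y} (above refl _) _ u≤z z≤ry =
      ⊥-elim (<Γ-irrefl (≤-<Γ-trans (≤Γ-trans u≤z z≤ry) (<Γ-sucΓ (r y))))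
    Over-squeeze (at-top refl ¬su∈R) z∈R u≤z z≤ry with ≤Γ-antisym u≤z z≤ry
    ... | refl = ¬InR-sucΓ⇒top z∈R ¬su∈R

    Y-r-r : ∀ {y} → Y S′ y ≡ true → Y S′ (r (r y)) ≡ true
    Y-r-r {y} Yy = trans (cong (Y S′) (r-involutive y)) Yy

    reflY-over : ∀ {y} → Y S′ y ≡ true → Σ Carrier (λ u → (reflY u ≡ true) × Over y u)
    reflY-over {y} Yy with inR? α β (sucΓ (r y))
    ... | yes su∈R = sucΓ (r y) ,
      ∧-true (isInR-true su∈R) (∨-trueˡ (trans (cong (λ w → Y S′ (r w)) (predΓ-sucΓ (r y))) (Y-r-r Yy))) ,
      above refl su∈R
    ... | no ¬su∈R = r y ,
      ∧-true (isInR-true (InR-reflect⁻ (Y⊆R S′ y Yy))) (∨-trueʳ (∧-true (not-false (isInR-false ¬su∈R)) (Y-r-r Yy))) ,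
      at-top refl ¬su∈R

    reflY-source : ∀ {u} → reflY u ≡ true → Σ Carrier (λ y → (Y S′ y ≡ true) × Over y u)
    reflY-source {u} e with ∧-true⁻ e
    ... | u∈R , e′ with ∨-true⁻ e′
    ... | inj₁ Y-pred = r (predΓ u) , Y-pred ,
      above (sym (trans (cong sucΓ (r-involutive (predΓ u))) (sucΓ-predΓ u))) (isInR-true⁻ u∈R)
    ... | inj₂ e″ with ∧-true⁻ e″
    ... | su∉R , Yu = r u , Yu , at-top (sym (r-involutive u)) (isInR-false⁻ (not-true⁻ su∉R))

    reflY-unique : ∀ u₁ u₂ → reflY u₁ ≡ true → reflY u₂ ≡ true → π u₁ ≡ π u₂ → u₁ ≡ u₂
    reflY-unique u₁ u₂ e₁ e₂ πu₁≡πu₂ with reflY-source e₁ | reflY-source e₂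
    ... | y₁ , Yy₁ , o₁ | y₂ , Yy₂ , o₂ = Over-unique o₁ (subst (λ y → Over y u₂) (sym y₁≡y₂) o₂)
      where
        y₁≡y₂ : y₁ ≡ y₂
        y₁≡y₂ = Y-unique S′ y₁ y₂ Yy₁ Yy₂
                  (π-r-cancel (trans (sym (Over-π o₁)) (trans πu₁≡πu₂ (Over-π o₂))))

    reflY-meets : ∀ z → InR α β z → Σ Carrier (λ u → (reflY u ≡ true) × (π u ≡ π z))
    reflY-meets z z∈R with Y-meets S′ (r z) (InR-reflect z∈R)
    ... | y , Yy , πy≡πrz with reflY-over Yy
    ... | u , reflYu , o = u , reflYu , trans (Over-π o) (π-r-r πy≡πrz)

    reflY-valid : ValidY α β reflY
    reflY-valid = (λ u e → isInR-true⁻ (proj₁ (∧-true⁻ e))) , reflY-unique , reflY-meets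

    reflExceptions : List Carrier
    reflExceptions = map r (exceptions S′) ++ top α

    module Fibre (z : Carrier) (z∉ : ¬ (z ∈ reflExceptions)) (z∈R : InR α β z)
                 {y : Carrier} (Yy : Y S′ y ≡ true) (πy≡πrz : π y ≡ π (r z))
                 {u : Carrier} (reflYu : reflY u ≡ true) (u-over : Over y u) where

      rz∉ : ¬ (r z ∈ exceptions S′)
      rz∉ m = z∉ (∈-++⁺ˡ (subst (_∈ map r (exceptions S′)) (r-involutive z) (∈-map⁺ r m)))

      πu≡πz : π u ≡ π z
      πu≡πz = trans (Over-π u-over) (π-r-r πy≡πrz)

      A′-true⇒ : A S′ (r z) ≡ true → z ≤Γ r y
      A′-true⇒ e = subst (_≤Γ r y) (r-involutive z)
        (r-anti-≤Γ (InT⇒≥ (Y-unique S′) Yy πy≡πrz (proj₁ (near-at S′ (r z) rz∉) e)))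

      A′-false⇒ : A S′ (r z) ≡ false → r y <Γ z
      A′-false⇒ e with cmp (fin (r z)) (fin y)
      ... | inj₁ y≤rz = ⊥-elim (true≢false (trans (sym (proj₂ (near-at S′ (r z) rz∉)
                            (≥⇒InT Yy (InR-reflect z∈R) πy≡πrz (≤̆⇒≤Γ y≤rz)))) e))
      ... | inj₂ rz<y = subst (r y <Γ_) (r-involutive z) (r-anti-<Γ (<̆⇒<Γ rz<y))

      A′-false⇒InT : A S′ (r z) ≡ false → InT α β reflY z
      A′-false⇒InT e = ≥⇒InT reflYu z∈R πu≡πz (Over-≤Γ u-over (A′-false⇒ e))

      InT⇒A′-false : InT α β reflY z → A S′ (r z) ≡ false
      InT⇒A′-false z∈T = ≢true⇒≡false λ e → z∉ (∈-++⁺ʳ (map r (exceptions S′))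
        (Over-squeeze u-over z∈R (InT⇒≥ reflY-unique reflYu πu≡πz z∈T) (A′-true⇒ e)))

    A′-false⇔InT : ∀ z → ¬ (z ∈ reflExceptions) → InR α β z →
                   (A S′ (r z) ≡ false → InT α β reflY z) × (InT α β reflY z → A S′ (r z) ≡ false)
    A′-false⇔InT z z∉ z∈R with Y-meets S′ (r z) (InR-reflect z∈R)
    ... | y , Yy , πy≡πrz with reflY-over Yy
    ... | u , reflYu , u-over = A′-false⇒InT , InT⇒A′-false
      where open Fibre z z∉ z∈R Yy πy≡πrz reflYu u-over

    reflA-near : Near reflA (InT α β reflY)
    reflA-near = reflExceptions , λ z z∉ → to z z∉ , from z z∉
      where
        to : ∀ z → ¬ (z ∈ reflExceptions) → reflA z ≡ true → InT α β reflY z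
        to z z∉ e with ∧-true⁻ e
        ... | z∈R , A′-false = proj₁ (A′-false⇔InT z z∉ (isInR-true⁻ z∈R)) (not-true⁻ A′-false)
        from : ∀ z → ¬ (z ∈ reflExceptions) → InT α β reflY z → reflA z ≡ true
        from z z∉ z∈T = ∧-true (isInR-true (proj₁ z∈T))
                               (not-false (proj₂ (A′-false⇔InT z z∉ (proj₁ z∈T)) z∈T))

    reflectSub : Sub α β
    reflectSub = record
      { A = reflA ; A⊆R = λ z e → isInR-true⁻ (proj₁ (∧-true⁻ e))
      ; Y = reflY ; Yok = reflY-valid ; near = reflA-near }

  open Reflect using (reflectSub)

  module _ {α β : Breve} (S′ : Sub (orth β) (orth α)) {z : Carrier} where

    reflA-true⁻ : A (reflectSub α β S′) z ≡ true → InR α β z × (A S′ (r z) ≡ false)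
    reflA-true⁻ e with ∧-true⁻ e
    ... | z∈R , notA = isInR-true⁻ z∈R , not-true⁻ notA

    reflA-true : InR α β z → A S′ (r z) ≡ false → A (reflectSub α β S′) z ≡ true
    reflA-true z∈R A-false = ∧-true (isInR-true z∈R) (not-false A-false)

    reflA-false : A S′ (r z) ≡ true → A (reflectSub α β S′) z ≡ false
    reflA-false A-true = trans (cong (λ b → isInR α β z ∧ not b) A-true) (∧-zeroʳ _)

    reflA-false⁻ : InR α β z → A (reflectSub α β S′) z ≡ false → A S′ (r z) ≡ true
    reflA-false⁻ z∈R e = not-false⁻ (trans (sym (cong (_∧ not (A S′ (r z))) (isInR-true z∈R))) e)

  reflectC : ∀ α β → C α β → C (orth β) (orth α)
  reflectC α β p = record { d = λ S′ → ℤ.- d p (reflectSub α β S′) ; law = reflect-law }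
    where
      reflect-law : ∀ (S₁ S₂ : Sub (orth β) (orth α)) → (∀ x → A S₁ x ≡ true → A S₂ x ≡ true) →
                    (L : List Carrier) → Unique L →
                    (∀ x → x ∈ L → (A S₂ x ≡ true) × (A S₁ x ≡ false)) →
                    (∀ x → A S₂ x ≡ true → A S₁ x ≡ false → x ∈ L) →
                    ℤ.- d p (reflectSub α β S₂) ≡ ℤ.- d p (reflectSub α β S₁) ℤ.+ ℤ⁺ (length L)
      reflect-law S₁ S₂ A₁⊆A₂ L uniq L⊆A₂∖A₁ A₂∖A₁⊆L = neg-shift _ (trans
        (law p (reflectSub α β S₂) (reflectSub α β S₁) antitone (map r L) (map⁺ r-injective uniq) rL⊆reflected-diff reflected-diff⊆rL)
        (cong (λ n → d p (reflectSub α β S₂) ℤ.+ ℤ⁺ n) (length-map r L)))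
        where
          antitone : ∀ z → A (reflectSub α β S₂) z ≡ true → A (reflectSub α β S₁) z ≡ true
          antitone z e with reflA-true⁻ S₂ e
          ... | z∈R , A₂-false = reflA-true S₁ z∈R
                  (≢true⇒≡false λ A₁-true → true≢false (trans (sym (A₁⊆A₂ (r z) A₁-true)) A₂-false))
          rL⊆reflected-diff : ∀ z → z ∈ map r L → (A (reflectSub α β S₁) z ≡ true) × (A (reflectSub α β S₂) z ≡ false)
          rL⊆reflected-diff z z∈rL with ∈-map⁻ r z∈rL
          ... | w , w∈L , refl with L⊆A₂∖A₁ w w∈L
          ... | A₂-true , A₁-false =
                  reflA-true S₁ (InR-reflect⁻ (A⊆R S₂ w A₂-true)) (trans (cong (A S₁) (r-involutive w)) A₁-false) ,
                  reflA-false S₂ (trans (cong (A S₂) (r-involutive w)) A₂-true)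
          reflected-diff⊆rL : ∀ z → A (reflectSub α β S₁) z ≡ true → A (reflectSub α β S₂) z ≡ false → z ∈ map r L
          reflected-diff⊆rL z e₁ e₂ with reflA-true⁻ S₁ e₁
          ... | z∈R , A₁-false = subst (_∈ map r L) (r-involutive z)
                  (∈-map⁺ r (A₂∖A₁⊆L (r z) (reflA-false⁻ S₂ z∈R e₂) A₁-false))

  -- Here both torsors are ℤ: the identity, not the negation of reflectC, is compatible with Unit.
  reflectEmptyC : ∀ α β → β ≡ α → C α β → C (orth α) (orth β)
  reflectEmptyC α β β≡α p = record { d = λ _ → d p (emptySub α β β≡α) ; law = empty-law }
    where
      empty-law : ∀ (S₁ S₂ : Sub (orth α) (orth β)) → (∀ x → A S₁ x ≡ true → A S₂ x ≡ true) →
                  (L : List Carrier) → Unique L →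
                  (∀ x → x ∈ L → (A S₂ x ≡ true) × (A S₁ x ≡ false)) →
                  (∀ x → A S₂ x ≡ true → A S₁ x ≡ false → x ∈ L) →
                  d p (emptySub α β β≡α) ≡ d p (emptySub α β β≡α) ℤ.+ ℤ⁺ (length L)
      empty-law _ _ _ [] _ _ _ = sym (ℤP.+-identityʳ _)
      empty-law _ S₂ _ (w ∷ _) _ L⊆A₂∖A₁ _ =
        ⊥-elim (InR-empty (cong orth β≡α) (A⊆R S₂ w (proj₁ (L⊆A₂∖A₁ w (here refl)))))

  reflectC-Cat : ∀ {x y z} → y ≤̆ x → z ≤̆ y → (p : C x y) (q : C y z) (w : C x z) →
                 Cat p q w → Cat (reflectC y z q) (reflectC x y p) (reflectC x z w)
  reflectC-Cat {x} {y} {z} y≤x z≤y p q w cat S₁ S₂ S A≗ =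
    trans (cong ℤ.-_ (cat (reflectSub x y S₂) (reflectSub y z S₁) (reflectSub x z S) split))
          (trans (ℤP.neg-distrib-+ (d p (reflectSub x y S₂)) (d q (reflectSub y z S₁)))
                 (ℤP.+-comm (ℤ.- d p (reflectSub x y S₂)) (ℤ.- d q (reflectSub y z S₁))))
    where
      split : ∀ t → A (reflectSub x z S) t ≡ (A (reflectSub x y S₂) t ∨ A (reflectSub y z S₁) t)
      split t with A S (r t) | A≗ (r t) | inR? x y t | inR? y z t | inR? x z t
      ... | _ | refl | yes t∈xy | yes t∈yz | _ = ⊥-elim (InR-disjoint t∈xy t∈yz)
      ... | _ | refl | yes t∈xy | no _ | no t∉xz = ⊥-elim (t∉xz (InR-⊆ˡ z≤y t∈xy))
      ... | _ | refl | yes t∈xy | no t∉yz | yes t∈xz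
        rewrite isInR-true t∈xy | isInR-false t∉yz | isInR-true t∈xz | A-outside S₁ t∉yz = sym (∨-identityʳ _)
      ... | _ | refl | no _ | yes t∈yz | no t∉xz = ⊥-elim (t∉xz (InR-⊆ʳ y≤x t∈yz))
      ... | _ | refl | no t∉xy | yes t∈yz | yes t∈xz
        rewrite isInR-false t∉xy | isInR-true t∈yz | isInR-true t∈xz | A-outside S₂ t∉xy = cong not (∨-identityʳ _)
      ... | _ | refl | no t∉xy | no t∉yz | yes t∈xz = ⊥-elim ([ t∉xy , t∉yz ] (InR-split y t∈xz))
      ... | _ | refl | no t∉xy | no t∉yz | no t∉xz
        rewrite isInR-false t∉xy | isInR-false t∉yz | isInR-false t∉xz = refl

  reflectC-Cat-emptyˡ : ∀ {x y z} (e : y ≡ x) (u : C x y) (v : C y z) (w : C x z) → Cat u v w →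
                        Cat (reflectC x z w) (reflectEmptyC x y e u) (reflectC y z v)
  reflectC-Cat-emptyˡ {x} {z = z} refl u v w cat S₁ S₂ S A≗ =
    neg-shift _ (trans (cat (emptySub x x refl) (reflectSub x z S) (reflectSub x z S₁) split)
                       (ℤP.+-comm (d u (emptySub x x refl)) (d v (reflectSub x z S))))
    where
      split : ∀ t → A (reflectSub x z S₁) t ≡ (false ∨ A (reflectSub x z S) t)
      split t rewrite A≗ (r t) | A-empty S₂ (r t) = cong (λ b → isInR x z t ∧ not b) (sym (∨-identityʳ _))

  reflectC-Cat-emptyʳ : ∀ {x z z′} (e : z′ ≡ z) (u : C x z) (v : C z z′) (w : C x z′) → Cat u v w →
                        Cat (reflectEmptyC z z′ e v) (reflectC x z′ w) (reflectC x z u)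
  reflectC-Cat-emptyʳ {x} {z} refl u v w cat S₁ S₂ S A≗ =
    trans (neg-shift _ (cat (reflectSub x z S) (emptySub z z refl) (reflectSub x z S₂) split))
          (ℤP.+-comm (ℤ.- d w (reflectSub x z S₂)) (d v (emptySub z z refl)))
    where
      split : ∀ t → A (reflectSub x z S₂) t ≡ (A (reflectSub x z S) t ∨ false)
      split t rewrite A≗ (r t) | A-empty S₁ (r t) = sym (∨-identityʳ _)

  reflectEmptyC-Cat : ∀ {x y z} (e₁ : y ≡ x) (e₂ : z ≡ y) (e₃ : z ≡ x) (u : C x y) (v : C y z) (w : C x z) →
                      Cat u v w → Cat (reflectEmptyC x y e₁ u) (reflectEmptyC y z e₂ v) (reflectEmptyC x z e₃ w)
  reflectEmptyC-Cat {x} {y} {z} e₁ e₂ e₃ u v w cat _ _ _ _ =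
    cat (emptySub x y e₁) (emptySub y z e₂) (emptySub x z e₃) (λ _ → refl)

  data Orientation {α β : Breve} : Ord α β → Ord (orth α) (orth β) → Set where
    gt : ∀ β<α o′ → Orientation (inj₁ (inj₁ β<α)) (inj₂ o′)
    eq : ∀ β≡α o′ → Orientation (inj₁ (inj₂ β≡α)) (inj₁ o′)
    lt : ∀ α<β o′ → Orientation (inj₂ α<β) (inj₁ o′)

  orientation : ∀ {α β} (o : Ord α β) (o′ : Ord (orth α) (orth β)) → Orientation o o′
  orientation (inj₁ (inj₁ β<α)) (inj₁ orthβ≤orthα) = ⊥-elim (<⇒≱̆ (orth-anti-<̆ β<α) orthβ≤orthα)
  orientation (inj₁ (inj₁ β<α)) (inj₂ o′) = gt β<α o′
  orientation (inj₁ (inj₂ β≡α)) (inj₁ o′) = eq β≡α o′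
  orientation {α} (inj₁ (inj₂ β≡α)) (inj₂ orthα<orthβ) =
    ⊥-elim (<̆-irrefl (subst (λ v → orth α <̆ orth v) β≡α orthα<orthβ))
  orientation (inj₂ α<β) (inj₁ o′) = lt α<β o′
  orientation (inj₂ α<β) (inj₂ orthα<orthβ) = ⊥-elim (<̆-irrefl (<̆-trans (orth-anti-<̆ α<β) orthα<orthβ))

  reflectO : ∀ α β (o : Ord α β) (o′ : Ord (orth α) (orth β)) → TorO α β o → TorO (orth α) (orth β) o′
  reflectO α β o o′ p with orientation o o′
  ... | gt _ _ = reflectC α β p
  ... | eq β≡α _ = reflectEmptyC α β β≡α p
  ... | lt _ _ = reflectC β α p

  reflectT : ∀ α β → Tor α β → Tor (orth α) (orth β)
  reflectT α β = reflectO α β (cmp α β) (cmp (orth α) (orth β))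

  reflectO-≈ : ∀ α β (o : Ord α β) (o′ : Ord (orth α) (orth β)) (p q : TorO α β o) →
               eqO α β o p q → eqO (orth α) (orth β) o′ (reflectO α β o o′ p) (reflectO α β o o′ q)
  reflectO-≈ α β o o′ p q p≈q with orientation o o′
  ... | gt _ _ = λ S → cong ℤ.-_ (p≈q (reflectSub α β S))
  ... | eq β≡α _ = λ _ → p≈q (emptySub α β β≡α)
  ... | lt _ _ = λ S → cong ℤ.-_ (p≈q (reflectSub β α S))

  reflectO-act : ∀ α β (o : Ord α β) (o′ : Ord (orth α) (orth β)) a (p : TorO α β o) →
                 eqO (orth α) (orth β) o′ (reflectO α β o o′ (actO α β o a p))
                                          (actO (orth α) (orth β) o′ a (reflectO α β o o′ p))
  reflectO-act α β o o′ a p with orientation o o′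
  ... | gt _ _ = λ S → ℤP.neg-distrib-+ (d p (reflectSub α β S)) a
  ... | eq _ _ = λ _ → refl
  ... | lt _ _ = λ S → trans (ℤP.neg-distrib-+ (d p (reflectSub β α S)) (ℤ.- a))
                             (cong (ℤ._+_ (ℤ.- d p (reflectSub β α S))) (ℤP.neg-involutive a))

  reflectO-Unit : ∀ α (o : Ord α α) (o′ : Ord (orth α) (orth α)) p k →
                  UnitO α o p k → UnitO (orth α) o′ (reflectO α α o o′ p) k
  reflectO-Unit α o o′ p k p↦k with orientation o o′
  ... | gt α<α _ = ⊥-elim (<̆-irrefl α<α)
  ... | eq α≡α _ = λ _ _ → p↦k (emptySub α α α≡α) (λ _ → refl)
  ... | lt α<α _ = ⊥-elim (<̆-irrefl α<α)

  reflectO-Comp : ∀ α β δ (o₁ : Ord α β) (o₂ : Ord β δ) (o₃ : Ord α δ)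
                  (o₁′ : Ord (orth α) (orth β)) (o₂′ : Ord (orth β) (orth δ)) (o₃′ : Ord (orth α) (orth δ)) p q w →
                  CompO α β δ o₁ o₂ o₃ p q w →
                  CompO (orth α) (orth β) (orth δ) o₁′ o₂′ o₃′
                        (reflectO α β o₁ o₁′ p) (reflectO β δ o₂ o₂′ q) (reflectO α δ o₃ o₃′ w)
  reflectO-Comp α β δ o₁ o₂ o₃ o₁′ o₂′ o₃′ p q w h
    with orientation o₁ o₁′ | orientation o₂ o₂′ | orientation o₃ o₃′
  ... | gt β<α _ | gt δ<β _ | gt _ _ = reflectC-Cat (inj₁ β<α) (inj₁ δ<β) p q w h
  ... | gt _ _ | eq δ≡β _ | gt _ _ = reflectC-Cat-emptyʳ δ≡β p q w h
  ... | gt _ _ | lt β<δ _ | gt δ<α _ = reflectC-Cat (inj₁ δ<α) (inj₁ β<δ) w q p h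
  ... | gt _ _ | lt _ _ | eq δ≡α _ = reflectC-Cat-emptyˡ δ≡α w q p h
  ... | gt β<α _ | lt _ _ | lt α<δ _ = reflectC-Cat (inj₁ α<δ) (inj₁ β<α) w p q h
  ... | eq β≡α _ | gt _ _ | gt _ _ = reflectC-Cat-emptyˡ β≡α p q w h
  ... | eq β≡α _ | eq δ≡β _ | eq δ≡α _ = reflectEmptyC-Cat β≡α δ≡β δ≡α p q w h
  ... | eq β≡α _ | lt _ _ | lt _ _ = reflectC-Cat-emptyʳ β≡α w p q h
  ... | lt α<β _ | gt _ _ | gt δ<α _ = reflectC-Cat (inj₁ α<β) (inj₁ δ<α) p w q h
  ... | lt _ _ | gt _ _ | eq δ≡α _ = reflectC-Cat-emptyʳ δ≡α p w q h
  ... | lt _ _ | gt δ<β _ | lt α<δ _ = reflectC-Cat (inj₁ δ<β) (inj₁ α<δ) q w p h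
  ... | lt _ _ | eq δ≡β _ | lt _ _ = reflectC-Cat-emptyˡ δ≡β q w p h
  ... | lt α<β _ | lt β<δ _ | lt _ _ = reflectC-Cat (inj₁ β<δ) (inj₁ α<β) q p w h
  ... | gt _ _ | gt _ _ | lt _ _ = ⊥-elim h
  ... | gt _ _ | eq _ _ | lt _ _ = ⊥-elim h
  ... | eq _ _ | gt _ _ | lt _ _ = ⊥-elim h
  ... | eq _ _ | eq _ _ | lt _ _ = ⊥-elim h
  ... | lt _ _ | lt _ _ | gt _ _ = ⊥-elim h
  ... | lt _ _ | lt _ _ | eq _ _ = ⊥-elim h
  ... | gt β<α _ | gt δ<β _ | eq δ≡α _ = ⊥-elim (<̆-irrefl (subst (_<̆ α) δ≡α (<̆-trans δ<β β<α)))
  ... | gt β<α _ | eq δ≡β _ | eq δ≡α _ = ⊥-elim (<̆-irrefl (subst (_<̆ α) (trans (sym δ≡β) δ≡α) β<α))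
  ... | eq β≡α _ | gt δ<β _ | eq δ≡α _ = ⊥-elim (<̆-irrefl (subst (_<̆ β) (trans δ≡α (sym β≡α)) δ<β))
  ... | eq β≡α _ | eq δ≡β _ | gt δ<α _ = ⊥-elim (<̆-irrefl (subst (_<̆ α) (trans δ≡β β≡α) δ<α))
  ... | eq β≡α _ | lt β<δ _ | gt δ<α _ = ⊥-elim (<̆-irrefl (<̆-trans (subst (_<̆ δ) β≡α β<δ) δ<α))
  ... | eq β≡α _ | lt β<δ _ | eq δ≡α _ = ⊥-elim (<̆-irrefl (subst (β <̆_) (trans δ≡α (sym β≡α)) β<δ))
  ... | lt α<β _ | eq δ≡β _ | gt δ<α _ = ⊥-elim (<̆-irrefl (<̆-trans α<β (subst (_<̆ α) δ≡β δ<α)))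
  ... | lt α<β _ | eq δ≡β _ | eq δ≡α _ = ⊥-elim (<̆-irrefl (subst (α <̆_) (trans (sym δ≡β) δ≡α) α<β))

  reflectC-Trans : ∀ φ α β (p : C α β) (p′ : C (fin φ ∘̆ α) (fin φ ∘̆ β)) → Trans φ p p′ →
                   Trans (- φ) (reflectC α β p) (reflectC (fin φ ∘̆ α) (fin φ ∘̆ β) p′)
  reflectC-Trans φ α β p p′ p↦p′ S S″ A≗ =
    cong ℤ.-_ (p↦p′ (reflectSub α β S) (reflectSub (fin φ ∘̆ α) (fin φ ∘̆ β) S″) translated)
    where
      translated : ∀ z → A (reflectSub (fin φ ∘̆ α) (fin φ ∘̆ β) S″) (φ + z) ≡ A (reflectSub α β S) z
      translated z = cong₂ _∧_ (isInR-translate φ α β z) (cong not (trans (cong (A S″) (r-+ φ z)) (A≗ (r z))))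

  reflectO-Trans : ∀ φ α β (o₁ : Ord α β) (o₂ : Ord (fin φ ∘̆ α) (fin φ ∘̆ β))
                   (o₁′ : Ord (orth α) (orth β)) (o₂′ : Ord (orth (fin φ ∘̆ α)) (orth (fin φ ∘̆ β))) p p′ →
                   TransO φ α β o₁ o₂ p p′ →
                   TransAt (- φ) (orth α) (orth β) (orth (fin φ ∘̆ α)) (orth (fin φ ∘̆ β)) o₁′ o₂′
                           (reflectO α β o₁ o₁′ p) (reflectO (fin φ ∘̆ α) (fin φ ∘̆ β) o₂ o₂′ p′)
  reflectO-Trans φ α β o₁ o₂ o₁′ o₂′ p p′ h with orientation o₁ o₁′ | orientation o₂ o₂′
  ... | gt _ _ | gt _ _ = reflectC-Trans φ α β p p′ h
  ... | lt _ _ | lt _ _ = reflectC-Trans φ β α p p′ h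
  ... | eq β≡α _ | eq φβ≡φα _ = λ _ _ _ → h (emptySub α β β≡α) (emptySub (fin φ ∘̆ α) (fin φ ∘̆ β) φβ≡φα) (λ _ → refl)
  ... | gt β<α _ | eq φβ≡φα _ = ⊥-elim (<̆-irrefl (subst (fin φ ∘̆ β <̆_) (sym φβ≡φα) (translate-<̆ φ β<α)))
  ... | eq β≡α _ | gt φβ<φα _ = ⊥-elim (<̆-irrefl (subst (fin φ ∘̆ β <̆_) (cong (fin φ ∘̆_) (sym β≡α)) φβ<φα))
  ... | gt _ _ | lt _ _ = ⊥-elim h
  ... | eq _ _ | lt _ _ = ⊥-elim h
  ... | lt _ _ | gt _ _ = ⊥-elim h
  ... | lt _ _ | eq _ _ = ⊥-elim h

module Transport (G : ExtGroup) where
  open WithGroup G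

  subst₂-≈T : ∀ {a b a′ b′} (e₁ : a ≡ a′) (e₂ : b ≡ b′) (u v : Tor a b) →
              _≈T_ {a} {b} u v → _≈T_ {a′} {b′} (subst₂ Tor e₁ e₂ u) (subst₂ Tor e₁ e₂ v)
  subst₂-≈T refl refl u v u≈v = u≈v

  subst₂-act : ∀ {a b a′ b′} (e₁ : a ≡ a′) (e₂ : b ≡ b′) k (u v : Tor a b) →
               _≈T_ {a} {b} u (act a b k v) →
               _≈T_ {a′} {b′} (subst₂ Tor e₁ e₂ u) (act a′ b′ k (subst₂ Tor e₁ e₂ v))
  subst₂-act refl refl k u v u≈kv = u≈kv

  subst₂-Unit : ∀ {a a′} (e : a ≡ a′) (u : Tor a a) k → Unit a u k → Unit a′ (subst₂ Tor e e u) k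
  subst₂-Unit refl u k u↦k = u↦k

  subst₂-Comp : ∀ {a b c a′ b′ c′} (e₁ : a ≡ a′) (e₂ : b ≡ b′) (e₃ : c ≡ c′) u v w → Comp a b c u v w →
                Comp a′ b′ c′ (subst₂ Tor e₁ e₂ u) (subst₂ Tor e₂ e₃ v) (subst₂ Tor e₁ e₃ w)
  subst₂-Comp refl refl refl u v w uv↦w = uv↦w

module PerpTorsors (G : ExtGroup)
                   (perp : ExtGroup.Carrier G → WithGroup.Breve G → WithGroup.Breve G)
                   (perp-isPerp : ∀ γ β → WithGroup.IsPerp G γ β (perp γ β)) where
  open WithGroup G
  open Translation G
  open Transport G
  open PerpLaws G
  open Perp G using (orth; perp-unique)
  open Reflection G using (reflectT; reflectO-≈; reflectO-act; reflectO-Unit; reflectO-Comp; reflectO-Trans)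

  perp≡orth : ∀ γ β → perp γ β ≡ orth γ β
  perp≡orth γ β = perp-unique γ (perp-isPerp γ β)

  perp-+ : ∀ γ₁ γ₂ β → perp (γ₁ + γ₂) β ≡ fin (- γ₂) ∘̆ perp γ₁ β
  perp-+ γ₁ γ₂ β = trans (perp≡orth (γ₁ + γ₂) β)
    (trans (orth-+-translate γ₁ γ₂ β) (cong (fin (- γ₂) ∘̆_) (sym (perp≡orth γ₁ β))))

  perp-translate : ∀ φ γ α → perp γ (fin φ ∘̆ α) ≡ fin (- φ) ∘̆ perp γ α
  perp-translate φ γ α = trans (perp≡orth γ (fin φ ∘̆ α))
    (trans (orth-translate φ γ α) (cong (fin (- φ) ∘̆_) (sym (perp≡orth γ α))))

  ψ : (γ : Carrier) → (α β : Breve) → Tor α β → Tor (perp γ α) (perp γ β)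
  ψ γ α β p = subst₂ Tor (sym (perp≡orth γ α)) (sym (perp≡orth γ β)) (reflectT γ α β p)

  ψ-≈ : ∀ γ α β (p q : Tor α β) → p ≈T q → ψ γ α β p ≈T ψ γ α β q
  ψ-≈ γ α β p q p≈q = subst₂-≈T (sym (perp≡orth γ α)) (sym (perp≡orth γ β)) _ _
    (reflectO-≈ γ α β (cmp α β) (cmp (orth γ α) (orth γ β)) p q p≈q)

  ψ-act : ∀ γ α β a (p : Tor α β) → ψ γ α β (act α β a p) ≈T act (perp γ α) (perp γ β) a (ψ γ α β p)
  ψ-act γ α β a p = subst₂-act (sym (perp≡orth γ α)) (sym (perp≡orth γ β)) a _ _
    (reflectO-act γ α β (cmp α β) (cmp (orth γ α) (orth γ β)) a p)

  ψ-Unit : ∀ γ α (p : Tor α α) k → Unit α p k → Unit (perp γ α) (ψ γ α α p) k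
  ψ-Unit γ α p k p↦k = subst₂-Unit (sym (perp≡orth γ α)) _ k
    (reflectO-Unit γ α (cmp α α) (cmp (orth γ α) (orth γ α)) p k p↦k)

  ψ-Comp : ∀ γ α β δ (p : Tor α β) (q : Tor β δ) (r : Tor α δ) → Comp α β δ p q r →
           Comp (perp γ α) (perp γ β) (perp γ δ) (ψ γ α β p) (ψ γ β δ q) (ψ γ α δ r)
  ψ-Comp γ α β δ p q r pq↦r = subst₂-Comp (sym (perp≡orth γ α)) (sym (perp≡orth γ β)) (sym (perp≡orth γ δ)) _ _ _
    (reflectO-Comp γ α β δ (cmp α β) (cmp β δ) (cmp α δ)
       (cmp (orth γ α) (orth γ β)) (cmp (orth γ β) (orth γ δ)) (cmp (orth γ α) (orth γ δ)) p q r pq↦r)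

  ψ-square : ∀ φ γ α β
             (e₁ : perp γ (fin φ ∘̆ α) ≡ fin (- φ) ∘̆ perp γ α)
             (e₂ : perp γ (fin φ ∘̆ β) ≡ fin (- φ) ∘̆ perp γ β)
             (p : Tor α β) (p′ : Tor (fin φ ∘̆ α) (fin φ ∘̆ β))
             (q : Tor (fin (- φ) ∘̆ perp γ α) (fin (- φ) ∘̆ perp γ β)) →
             TransT φ α β p p′ →
             TransT (- φ) (perp γ α) (perp γ β) (ψ γ α β p) q →
             subst₂ Tor e₁ e₂ (ψ γ (fin φ ∘̆ α) (fin φ ∘̆ β) p′) ≈T q
  ψ-square φ γ α β e₁ e₂ p p′ q p↦p′ ψp↦q =
    TransAt-unique (- φ) (perp γ α) (perp γ β) (cmp _ _) (cmp _ _) (ψ γ α β p) _ q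
      ψp↦ψp′ (TransO⇒TransAt (- φ) (perp γ α) (perp γ β) _ _ (ψ γ α β p) q ψp↦q)
    where
      φα φβ : Breve
      φα = fin φ ∘̆ α
      φβ = fin φ ∘̆ β

      reflected : TransTor (- φ) (orth γ α) (orth γ β) (orth γ φα) (orth γ φβ)
                           (reflectT γ α β p) (reflectT γ φα φβ p′)
      reflected = reflectO-Trans γ φ α β (cmp α β) (cmp φα φβ)
                    (cmp (orth γ α) (orth γ β)) (cmp (orth γ φα) (orth γ φβ)) p p′ p↦p′

      ψp↦ψp′ : TransTor (- φ) (perp γ α) (perp γ β) (fin (- φ) ∘̆ perp γ α) (fin (- φ) ∘̆ perp γ β)
                        (ψ γ α β p) (subst₂ Tor e₁ e₂ (ψ γ φα φβ p′))
      ψp↦ψp′ = TransTor-substˡ (- φ) _ _ (sym (perp≡orth γ α)) (sym (perp≡orth γ β)) _ _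
                 (TransTor-substʳ (- φ) (orth γ α) (orth γ β) e₁ e₂ _ _
                   (TransTor-substʳ (- φ) (orth γ α) (orth γ β) (sym (perp≡orth γ φα)) (sym (perp≡orth γ φβ)) _ _
                     reflected))

proposition9 :
    (G : ExtGroup) → let open WithGroup G in
    (perp : Carrier → Breve → Breve) →
    (∀ γ β → IsPerp γ β (perp γ β)) →
    -- (1)
    (∀ γ₁ γ₂ β → perp (γ₁ + γ₂) β ≡ fin (- γ₂) ∘̆ perp γ₁ β) ×
    -- (2)
    (∀ φ γ α → perp γ (fin φ ∘̆ α) ≡ fin (- φ) ∘̆ perp γ α) ×
    -- (3) and (4)
    Σ ((γ : Carrier) → (α β : Breve) → Tor α β → Tor (perp γ α) (perp γ β))
      (λ ψ →
        -- ψ is a well-defined map of ℤ-torsors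
        (∀ γ α β (p q : Tor α β) → p ≈T q → ψ γ α β p ≈T ψ γ α β q) ×
        (∀ γ α β a (p : Tor α β) →
           ψ γ α β (act α β a p) ≈T act (perp γ α) (perp γ β) a (ψ γ α β p)) ×
        -- compatibility with [α , α] ≅ ℤ
        (∀ γ α (p : Tor α α) k → Unit α p k → Unit (perp γ α) (ψ γ α α p) k) ×
        -- compatibility with [α , β] ⊗ [β , δ] ≅ [α , δ]
        (∀ γ α β δ (p : Tor α β) (q : Tor β δ) (r : Tor α δ) →
           Comp α β δ p q r →
           Comp (perp γ α) (perp γ β) (perp γ δ)
                (ψ γ α β p) (ψ γ β δ q) (ψ γ α δ r)) ×
        -- (4) the square with the translations by φ and - φ commutes
        (∀ φ γ α β
           (e₁ : perp γ (fin φ ∘̆ α) ≡ fin (- φ) ∘̆ perp γ α)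
           (e₂ : perp γ (fin φ ∘̆ β) ≡ fin (- φ) ∘̆ perp γ β)
           (p : Tor α β) (p' : Tor (fin φ ∘̆ α) (fin φ ∘̆ β))
           (q : Tor (fin (- φ) ∘̆ perp γ α) (fin (- φ) ∘̆ perp γ β)) →
           TransT φ α β p p' →
           TransT (- φ) (perp γ α) (perp γ β) (ψ γ α β p) q →
           subst₂ Tor e₁ e₂ (ψ γ (fin φ ∘̆ α) (fin φ ∘̆ β) p') ≈T q))
proposition9 G perp perp-isPerp =
  perp-+ , perp-translate , ψ , ψ-≈ , ψ-act , ψ-Unit , ψ-Comp , ψ-square
  where open PerpTorsors G perp perp-isPerp
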